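{- Let $K\ge2$, $\alpha\in[0,1]$, $\gamma\in(0,1]$. Let $\mathcal{V}$ be a ground set consisting of $2K$ distinct elements $S=\{j_1,\dots,j_K\}$ and $\Omega=\{\omega_1,\dots,\omega_K\}$ (with $S\cap\Omega=\emptyset$) together with $n-2K$ further dummy elements. Let $\xi_i:=\frac1K\left(\frac{K-\gamma\alpha}{K}\right)^{i-1}$ for $i\in[K]$, $f(x):=\frac{\gamma^{ -1}-1}{K-1}x^2+\frac{K-\gamma^{ -1}}{K-1}x$, and define for $T\subseteq\mathcal{V}$ $$F(T):=\frac{f(|\Omega\cap T|)}{K}\Big(1-\alpha\gamma\sum_{i:\,j_i\in S\cap T}\xi_i\Big)+\sum_{i:\,j_i\in S\cap T}\xi_i.$$ Then: (a) if $\alpha=0$, $F$ is supermodular; (b) if $\gamma=1$, $F$ is submodular; (c) $F$ has submodularity ratio $\gamma$ and curvature $\alpha$.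
   Context: For $A,B\subseteq\mathcal{V}$, $\rho_A(B):=F(A\cup B)-F(B)$, $\rho_v(B):=\rho_{\{v\}}(B)$. The submodularity ratio of $F$ is the largest scalar $\gamma'$ with $\sum_{\omega\in A\setminus B}\rho_\omega(B)\ge\gamma'\rho_A(B)$ for all $A,B\subseteq\mathcal{V}$. The curvature of $F$ is the smallest scalar $\alpha'$ with $\rho_i(B\setminus\{i\}\cup A)\ge(1-\alpha')\rho_i(B\setminus\{i\})$ for all $A,B\subseteq\mathcal{V}$ and $i\in B\setminus A$. -}

module Defs where

open import Data.Nat using (ℕ; zero; suc)
open import Data.Bool using (Bool; true; false; if_then_else_; _∧_; not)
open import Data.Fin using (Fin)
open import Data.Fin.Subset using (Subset; _∪_; _∩_; _-_; _∈_; _∉_)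
open import Data.Vec using (lookup)
open import Relation.Binary.PropositionalEquality using (_≡_; _≢_)
open import Relation.Binary.Structures using (IsTotalOrder)
open import Algebra.Structures using (IsCommutativeRing)
open import Data.Product using (_×_)

-- An ordered field (the reals are one instance).  Equality is propositional.
-- _⁻¹ is total; its value at 0# is unconstrained.
record OrderedField : Set₁ where
  infixl 6 _+_ _-ᶠ_
  infixl 7 _*_
  infix 4 _≤_ _<_
  field
    Carrier : Set
    _+_ _*_ : Carrier → Carrier → Carrier
    -_ : Carrier → Carrier
    0# 1# : Carrier
    _⁻¹ : Carrier → Carrier
    _≤_ : Carrier → Carrier → Set
    isCommutativeRing : IsCommutativeRing _≡_ _+_ _*_ -_ 0# 1#
    0≢1 : 0# ≢ 1#
    ⁻¹-inverse : ∀ x → x ≢ 0# → x * (x ⁻¹) ≡ 1#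
    isTotalOrder : IsTotalOrder _≡_ _≤_
    +-mono-≤ : ∀ {x y} z → x ≤ y → x + z ≤ y + z
    *-nonneg : ∀ {x y} → 0# ≤ x → 0# ≤ y → 0# ≤ x * y

  _-ᶠ_ : Carrier → Carrier → Carrier
  x -ᶠ y = x + (- y)

  _<_ : Carrier → Carrier → Set
  x < y = (x ≤ y) × (x ≢ y)

  _/_ : Carrier → Carrier → Carrier
  x / y = x * (y ⁻¹)

  fromℕ : ℕ → Carrier
  fromℕ zero = 0#
  fromℕ (suc m) = 1# + fromℕ m

  _^_ : Carrier → ℕ → Carrier
  x ^ zero = 1#
  x ^ suc m = x * (x ^ m)

  sumFin : (m : ℕ) → (Fin m → Carrier) → Carrier
  sumFin zero g = 0#
  sumFin (suc m) g = g Fin.zero + sumFin m (λ i → g (Fin.suc i))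

module _ (𝔽 : OrderedField) where
  open OrderedField 𝔽

  ifB : Bool → Carrier → Carrier
  ifB b x = if b then x else 0#

  ρ : ∀ {n} → (Subset n → Carrier) → Subset n → Subset n → Carrier
  ρ F A B = F (A ∪ B) -ᶠ F B

  ρ₁ : ∀ {n} → (Subset n → Carrier) → Fin n → Subset n → Carrier
  ρ₁ F v B = ρ F (Data.Fin.Subset.⁅ v ⁆) B

  Submodular : ∀ {n} → (Subset n → Carrier) → Set
  Submodular F = ∀ A B → F (A ∪ B) + F (A ∩ B) ≤ F A + F B

  Supermodular : ∀ {n} → (Subset n → Carrier) → Set
  Supermodular F = ∀ A B → F A + F B ≤ F (A ∪ B) + F (A ∩ B)

  SatisfiesRatio : ∀ {n} → (Subset n → Carrier) → Carrier → Set
  SatisfiesRatio {n} F γ' = ∀ A B →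
    γ' * ρ F A B ≤ sumFin n (λ v → ifB (lookup A v ∧ not (lookup B v)) (ρ₁ F v B))

  IsSubmodularityRatio : ∀ {n} → (Subset n → Carrier) → Carrier → Set
  IsSubmodularityRatio F γ = SatisfiesRatio F γ × (∀ γ' → SatisfiesRatio F γ' → γ' ≤ γ)

  SatisfiesCurvature : ∀ {n} → (Subset n → Carrier) → Carrier → Set
  SatisfiesCurvature F α' = ∀ A B i → i ∈ B → i ∉ A →
    (1# -ᶠ α') * ρ₁ F i (B - i) ≤ ρ₁ F i ((B - i) ∪ A)

  IsCurvature : ∀ {n} → (Subset n → Carrier) → Carrier → Set
  IsCurvature F α = SatisfiesCurvature F α × (∀ α' → SatisfiesCurvature F α' → α ≤ α')

  -- The construction.  S = {j i}, Ω = {ω i}, indices i : Fin K stand for 1..K,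
  -- so ξ at Fin-index i is (1/K)((K-γα)/K)^(toℕ i).
  module Construction (K n : ℕ) (α γ : Carrier) (j ω : Fin K → Fin n) where
    Kᶠ : Carrier
    Kᶠ = fromℕ K

    ξ : Fin K → Carrier
    ξ i = (1# / Kᶠ) * (((Kᶠ -ᶠ γ * α) / Kᶠ) ^ Data.Fin.toℕ i)

    f : Carrier → Carrier
    f x = ((γ ⁻¹ -ᶠ 1#) / (Kᶠ -ᶠ 1#)) * (x * x) + ((Kᶠ -ᶠ γ ⁻¹) / (Kᶠ -ᶠ 1#)) * x

    countΩ : Subset n → Carrier
    countΩ T = sumFin K (λ i → ifB (lookup T (ω i)) 1#)

    sumξ : Subset n → Carrier
    sumξ T = sumFin K (λ i → ifB (lookup T (j i)) (ξ i))

    F : Subset n → Carrier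
    F T = (f (countΩ T) / Kᶠ) * (1# -ᶠ α * γ * sumξ T) + sumξ T

module Submission where

-- F(T) = f(|Ω ∩ T|)/K · (1 - αγ Σ_{j_i ∈ T} ξ_i) + Σ_{j_i ∈ T} ξ_i depends on T only
-- through the count c = |Ω ∩ T| and the weight s = Σ_{j_i ∈ T} ξ_i.  Hence its
-- marginal gains are explicit: ω_k ∉ T gains (f(c+1) - f(c))/K · (1 - αγ s), j_k ∉ T
-- gains ξ_k (1 - αγ f(c)/K), and a dummy element gains nothing.  All four claims
-- then reduce to scalar facts about the profile, f(x) = x + p·x(x-1) with
-- p = (1/γ - 1)/(K-1) ≥ 0 (convex on ℕ, f(K) = K/γ, γ(f(c+d) - f(c)) ≤ d(f(c+1) - f(c))
-- for c + d ≤ K), and about the weights ξ_i ∈ [0, 1/K].  (a) and (b) follow from the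
-- Venn decomposition of c and s over A, B; the ratio and curvature bounds are tight
-- at A = Ω, B = ∅ and at i = j_1, B = {j_1}, A = Ω respectively.

open import Defs
open import Data.Nat using (ℕ) renaming (_≤_ to _≤ℕ_)
open import Data.Fin as Fin using (Fin)
open import Data.Product using (_×_; _,_)
open import Relation.Binary.PropositionalEquality using (_≡_; _≢_)
open import Function.Definitions using (Injective)

-- The carrier is abstract,
-- so the solver's normal forms must carry integer coefficients, interpreted by
-- the ring homomorphism ℤ → Carrier, k ↦ k·1 (using the stdlib's optimised
-- repeated addition, for which 1·1 is 1# on the nose).
module FieldSolver (𝔽 : OrderedField) where
  open import Algebra.Bundles using (CommutativeRing; RawRing)
  open import Algebra.Solver.Ring.AlmostCommutativeRing
    using (AlmostCommutativeRing; fromCommutativeRing; _-Raw-AlmostCommutative⟶_)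
  open import Data.Maybe using (Maybe; just; nothing)
  open import Data.Nat as ℕ using (zero; suc)
  import Data.Nat.Properties as ℕ
  open import Data.Integer as ℤ using (ℤ; -[1+_]; _⊖_; _◃_)
  import Data.Integer.Properties as ℤ
  open import Data.Sign as Sign using (Sign)
  open import Relation.Binary.PropositionalEquality using (refl; sym; trans; cong; cong₂; module ≡-Reasoning)
  open import Relation.Nullary using (yes; no)
  open OrderedField 𝔽 using (isCommutativeRing)

  commutativeRing : CommutativeRing _ _
  commutativeRing = record { isCommutativeRing = isCommutativeRing }

  open CommutativeRing commutativeRing
    using (Carrier; _+_; _*_; -_; 0#; 1#; +-assoc; +-comm; +-identityˡ; +-identityʳ; -‿inverseʳ;
           ring; semiring; +-group; +-abelianGroup)
  open import Algebra.Properties.Ring ring using (-‿distribˡ-*; -‿distribʳ-*; -0#≈0#)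
  open import Algebra.Properties.AbelianGroup +-abelianGroup using (⁻¹-∙-comm)
  open import Algebra.Properties.Group +-group using (⁻¹-involutive)
  open import Algebra.Properties.Semiring.Mult.TCOptimised semiring using (×-homo-+; ×1-homo-*; 1+×) renaming (_×_ to _×ₙ_)
  open ≡-Reasoning

  ⟦_⟧ : ℤ → Carrier
  ⟦ ℤ.+ n ⟧ = n ×ₙ 1#
  ⟦ -[1+ n ] ⟧ = - (suc n ×ₙ 1#)

  private
    cancel-1 : ∀ x y → (1# + x) + - (1# + y) ≡ x + - y
    cancel-1 x y = begin
      (1# + x) + - (1# + y)     ≡⟨ cong ((1# + x) +_) (sym (⁻¹-∙-comm 1# y)) ⟩
      (1# + x) + (- 1# + - y)   ≡⟨ +-assoc 1# x _ ⟩
      1# + (x + (- 1# + - y))   ≡⟨ cong (1# +_) (trans (sym (+-assoc x _ _)) (cong (_+ - y) (+-comm x _))) ⟩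
      1# + ((- 1# + x) + - y)   ≡⟨ cong (1# +_) (+-assoc _ x _) ⟩
      1# + (- 1# + (x + - y))   ≡⟨ sym (+-assoc _ _ _) ⟩
      (1# + - 1#) + (x + - y)   ≡⟨ cong (_+ (x + - y)) (-‿inverseʳ 1#) ⟩
      0# + (x + - y)            ≡⟨ +-identityˡ _ ⟩
      x + - y                   ∎

  ⊖-homo : ∀ m n → ⟦ m ⊖ n ⟧ ≡ m ×ₙ 1# + - (n ×ₙ 1#)
  ⊖-homo zero zero = sym (-‿inverseʳ 0#)
  ⊖-homo (suc m) zero = sym (trans (cong (suc m ×ₙ 1# +_) -0#≈0#) (+-identityʳ _))
  ⊖-homo zero (suc n) = sym (+-identityˡ _)
  ⊖-homo (suc m) (suc n) = begin
    ⟦ suc m ⊖ suc n ⟧                    ≡⟨ cong ⟦_⟧ (ℤ.[1+m]⊖[1+n]≡m⊖n m n) ⟩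
    ⟦ m ⊖ n ⟧                            ≡⟨ ⊖-homo m n ⟩
    m ×ₙ 1# + - (n ×ₙ 1#)                ≡⟨ sym (cancel-1 _ _) ⟩
    (1# + m ×ₙ 1#) + - (1# + n ×ₙ 1#)    ≡⟨ sym (cong₂ (λ a b → a + - b) (1+× m 1#) (1+× n 1#)) ⟩
    suc m ×ₙ 1# + - (suc n ×ₙ 1#)        ∎

  +-homo : ∀ i j → ⟦ i ℤ.+ j ⟧ ≡ ⟦ i ⟧ + ⟦ j ⟧
  +-homo (ℤ.+ m) (ℤ.+ n) = ×-homo-+ 1# m n
  +-homo (ℤ.+ m) -[1+ n ] = ⊖-homo m (suc n)
  +-homo -[1+ m ] (ℤ.+ n) = trans (⊖-homo n (suc m)) (+-comm _ _)
  +-homo -[1+ m ] -[1+ n ] = begin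
    - (suc (suc (m ℕ.+ n)) ×ₙ 1#)        ≡⟨ cong (λ k → - (suc k ×ₙ 1#)) (sym (ℕ.+-suc m n)) ⟩
    - ((suc m ℕ.+ suc n) ×ₙ 1#)          ≡⟨ cong -_ (×-homo-+ 1# (suc m) (suc n)) ⟩
    - (suc m ×ₙ 1# + suc n ×ₙ 1#)        ≡⟨ sym (⁻¹-∙-comm _ _) ⟩
    - (suc m ×ₙ 1#) + - (suc n ×ₙ 1#)    ∎

  -‿homo : ∀ i → ⟦ ℤ.- i ⟧ ≡ - ⟦ i ⟧
  -‿homo (ℤ.+ zero) = sym -0#≈0#
  -‿homo (ℤ.+ suc n) = refl
  -‿homo -[1+ n ] = sym (⁻¹-involutive _)

  private
    ⟦sign⟧ : Sign → Carrier → Carrier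
    ⟦sign⟧ Sign.+ x = x
    ⟦sign⟧ Sign.- x = - x

    ◃-homo : ∀ s k → ⟦ s ◃ k ⟧ ≡ ⟦sign⟧ s (k ×ₙ 1#)
    ◃-homo Sign.+ zero = refl
    ◃-homo Sign.- zero = sym -0#≈0#
    ◃-homo Sign.+ (suc k) = refl
    ◃-homo Sign.- (suc k) = refl

  *-homo : ∀ i j → ⟦ i ℤ.* j ⟧ ≡ ⟦ i ⟧ * ⟦ j ⟧
  *-homo (ℤ.+ m) (ℤ.+ n) = trans (◃-homo _ (m ℕ.* n)) (×1-homo-* m n)
  *-homo (ℤ.+ m) -[1+ n ] =
    trans (◃-homo _ (m ℕ.* suc n)) (trans (cong -_ (×1-homo-* m (suc n))) (-‿distribʳ-* _ _))
  *-homo -[1+ m ] (ℤ.+ n) =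
    trans (◃-homo _ (suc m ℕ.* n)) (trans (cong -_ (×1-homo-* (suc m) n)) (-‿distribˡ-* _ _))
  *-homo -[1+ m ] -[1+ n ] = trans (×1-homo-* (suc m) (suc n))
    (trans (sym (⁻¹-involutive _)) (trans (cong -_ (-‿distribˡ-* _ _)) (-‿distribʳ-* _ _)))

  integers : RawRing _ _
  integers = record { Carrier = ℤ ; _≈_ = _≡_ ; _+_ = ℤ._+_ ; _*_ = ℤ._*_ ; -_ = ℤ.-_ ; 0# = ℤ.+ 0 ; 1# = ℤ.+ 1 }

  carrierRing : AlmostCommutativeRing _ _
  carrierRing = fromCommutativeRing commutativeRing

  integerCoefficients : integers -Raw-AlmostCommutative⟶ carrierRing
  integerCoefficients = record
    { ⟦_⟧ = ⟦_⟧ ; +-homo = +-homo ; *-homo = *-homo ; -‿homo = -‿homo ; 0-homo = refl ; 1-homo = refl }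

  coefficient≟ : ∀ a b → Maybe (⟦ a ⟧ ≡ ⟦ b ⟧)
  coefficient≟ a b with a ℤ.≟ b
  ... | yes a≡b = just (cong ⟦_⟧ a≡b)
  ... | no _ = nothing

  open import Algebra.Solver.Ring integers carrierRing integerCoefficients coefficient≟ public
    using (Polynomial; solve; _:=_; _:+_; _:*_; :-_; _:-_; con)

module OrderedFieldFacts (𝔽 : OrderedField) where
  open OrderedField 𝔽
  open FieldSolver 𝔽 public using (Polynomial; solve; _:=_; _:+_; _:*_; :-_; _:-_; con)
  open import Data.Integer using () renaming (+_ to ℤ+)
  open import Data.Sum using (inj₁; inj₂)
  open import Data.Nat as ℕ using (zero; suc)
  import Data.Nat.Properties as ℕ
  open import Relation.Binary.PropositionalEquality using (refl; sym; trans; cong; module ≡-Reasoning)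
  open import Relation.Binary.Structures using (IsTotalOrder)
  open IsTotalOrder isTotalOrder public using (antisym; total) renaming (refl to ≤-refl; trans to ≤-trans)

  𝟙 𝟘 : ∀ {k} → Polynomial k
  𝟙 = con (ℤ+ 1)
  𝟘 = con (ℤ+ 0)

  NonNeg : Carrier → Set
  NonNeg x = 0# ≤ x

  ≤-reflexive : ∀ {x y} → x ≡ y → x ≤ y
  ≤-reflexive refl = ≤-refl

  ≤-cong : ∀ {a b c d} → a ≡ b → c ≡ d → a ≤ c → b ≤ d
  ≤-cong refl refl a≤c = a≤c

  ≤⇒diff-nonneg : ∀ {x y} → x ≤ y → NonNeg (y -ᶠ x)
  ≤⇒diff-nonneg {x} x≤y = ≤-cong (solve 1 (λ x → x :- x := 𝟘) refl x) refl (+-mono-≤ (- x) x≤y)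

  diff-nonneg⇒≤ : ∀ {x y} → NonNeg (y -ᶠ x) → x ≤ y
  diff-nonneg⇒≤ {x} {y} d =
    ≤-cong (solve 1 (λ x → 𝟘 :+ x := x) refl x) (solve 2 (λ x y → (y :- x) :+ x := y) refl x y) (+-mono-≤ x d)

  by-difference : ∀ {x y} e → y -ᶠ x ≡ e → NonNeg e → x ≤ y
  by-difference e refl = diff-nonneg⇒≤

  nonneg-+ : ∀ {a b} → NonNeg a → NonNeg b → NonNeg (a + b)
  nonneg-+ {a} {b} a≥0 b≥0 = ≤-trans b≥0 (≤-cong (solve 1 (λ b → 𝟘 :+ b := b) refl b) refl (+-mono-≤ b a≥0))

  +-mono₂-≤ : ∀ {a b c d} → a ≤ b → c ≤ d → a + c ≤ b + d
  +-mono₂-≤ {a} {b} {c} {d} a≤b c≤d = by-difference _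
    (solve 4 (λ a b c d → (b :+ d) :- (a :+ c) := (b :- a) :+ (d :- c)) refl a b c d)
    (nonneg-+ (≤⇒diff-nonneg a≤b) (≤⇒diff-nonneg c≤d))

  *-monoʳ-≤ : ∀ {a b c} → NonNeg c → a ≤ b → a * c ≤ b * c
  *-monoʳ-≤ {a} {b} {c} c≥0 a≤b =
    by-difference _ (solve 3 (λ a b c → b :* c :- a :* c := (b :- a) :* c) refl a b c) (*-nonneg (≤⇒diff-nonneg a≤b) c≥0)

  *-monoˡ-≤ : ∀ {a b c} → NonNeg c → a ≤ b → c * a ≤ c * b
  *-monoˡ-≤ {a} {b} {c} c≥0 a≤b =
    by-difference _ (solve 3 (λ a b c → c :* b :- c :* a := c :* (b :- a)) refl a b c) (*-nonneg c≥0 (≤⇒diff-nonneg a≤b))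

  -- in a totally ordered ring, 1 is nonnegative: otherwise -1 ≥ 0 and 1 = (-1)(-1) ≥ 0
  0≤1 : NonNeg 1#
  0≤1 with total 0# 1#
  ... | inj₁ nonneg = nonneg
  ... | inj₂ 1≤0 = ≤-cong refl (solve 1 (λ _ → (:- 𝟙) :* (:- 𝟙) := 𝟙) refl 0#) (*-nonneg -1≥0 -1≥0)
    where
    -1≥0 : NonNeg (- 1#)
    -1≥0 = ≤-cong (solve 1 (λ _ → 𝟙 :- 𝟙 := 𝟘) refl 0#) (solve 1 (λ _ → 𝟘 :- 𝟙 := :- 𝟙) refl 0#) (+-mono-≤ (- 1#) 1≤0)

  0≤fromℕ : ∀ k → NonNeg (fromℕ k)
  0≤fromℕ zero = ≤-refl
  0≤fromℕ (suc k) = nonneg-+ 0≤1 (0≤fromℕ k)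

  positive⇒≢0 : ∀ {x} → 0# < x → x ≢ 0#
  positive⇒≢0 (_ , 0≢x) x≡0 = 0≢x (sym x≡0)

  ⁻¹-cancelˡ : ∀ {c} z → c ≢ 0# → c ⁻¹ * (c * z) ≡ z
  ⁻¹-cancelˡ {c} z c≢0 = begin
    c ⁻¹ * (c * z)   ≡⟨ solve 3 (λ c c' z → c' :* (c :* z) := (c :* c') :* z) refl c (c ⁻¹) z ⟩
    (c * c ⁻¹) * z   ≡⟨ cong (_* z) (⁻¹-inverse c c≢0) ⟩
    1# * z           ≡⟨ solve 1 (λ z → 𝟙 :* z := z) refl z ⟩
    z                ∎
    where open ≡-Reasoning

  nonneg-cancelˡ : ∀ {c z} → 0# < c → NonNeg (c * z) → NonNeg z
  nonneg-cancelˡ {c} {z} c>0@(c≥0 , _) cz≥0 with total 0# z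
  ... | inj₁ z≥0 = z≥0
  ... | inj₂ z≤0 = ≤-reflexive (sym z≡0)
    where
    open ≡-Reasoning
    cz≤0 : c * z ≤ 0#
    cz≤0 = by-difference _ (solve 2 (λ c z → 𝟘 :- c :* z := c :* (𝟘 :- z)) refl c z)
                           (*-nonneg c≥0 (≤⇒diff-nonneg z≤0))
    z≡0 : z ≡ 0#
    z≡0 = begin
      z                ≡⟨ sym (⁻¹-cancelˡ z (positive⇒≢0 c>0)) ⟩
      c ⁻¹ * (c * z)   ≡⟨ cong (c ⁻¹ *_) (antisym cz≤0 cz≥0) ⟩
      c ⁻¹ * 0#        ≡⟨ solve 1 (λ x → x :* 𝟘 := 𝟘) refl (c ⁻¹) ⟩
      0#               ∎

  *-cancelˡ-≤ : ∀ {c a b} → 0# < c → c * a ≤ c * b → a ≤ b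
  *-cancelˡ-≤ {c} {a} {b} c>0 ca≤cb = diff-nonneg⇒≤ (nonneg-cancelˡ c>0
    (≤-cong refl (solve 3 (λ c a b → c :* b :- c :* a := c :* (b :- a)) refl c a b) (≤⇒diff-nonneg ca≤cb)))

  ⁻¹-positive : ∀ {x} → 0# < x → 0# < x ⁻¹
  ⁻¹-positive {x} x>0 = nonneg-cancelˡ x>0 (≤-cong refl (sym x·x⁻¹≡1) 0≤1) , 0≢x⁻¹
    where
    x·x⁻¹≡1 : x * x ⁻¹ ≡ 1#
    x·x⁻¹≡1 = ⁻¹-inverse x (positive⇒≢0 x>0)
    0≢x⁻¹ : 0# ≢ x ⁻¹
    0≢x⁻¹ 0≡x⁻¹ = 0≢1 (trans (solve 1 (λ x → 𝟘 := x :* 𝟘) refl x) (trans (cong (x *_) 0≡x⁻¹) x·x⁻¹≡1))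

  ≥1⇒positive : ∀ {x} → 1# ≤ x → 0# < x
  ≥1⇒positive 1≤x = ≤-trans 0≤1 1≤x , λ 0≡x → 0≢1 (antisym 0≤1 (≤-cong refl (sym 0≡x) 1≤x))

  fromℕ-+ : ∀ a b → fromℕ (a ℕ.+ b) ≡ fromℕ a + fromℕ b
  fromℕ-+ zero b = solve 1 (λ b → b := 𝟘 :+ b) refl (fromℕ b)
  fromℕ-+ (suc a) b = trans (cong (1# +_) (fromℕ-+ a b)) (solve 2 (λ a b → 𝟙 :+ (a :+ b) := (𝟙 :+ a) :+ b) refl _ _)

  fromℕ-split : ∀ {a b} → a ≤ℕ b → fromℕ b ≡ fromℕ a + fromℕ (b ℕ.∸ a)
  fromℕ-split {a} {b} a≤b = trans (cong fromℕ (sym (ℕ.m+[n∸m]≡n a≤b))) (fromℕ-+ a (b ℕ.∸ a))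

  fromℕ-mono : ∀ {a b} → a ≤ℕ b → fromℕ a ≤ fromℕ b
  fromℕ-mono {a} {b} a≤b = by-difference (fromℕ (b ℕ.∸ a))
    (trans (cong (_-ᶠ fromℕ a) (fromℕ-split a≤b)) (solve 2 (λ a c → a :+ c :- a := c) refl _ _))
    (0≤fromℕ (b ℕ.∸ a))

  1≤fromℕ : ∀ {k} → 1 ≤ℕ k → 1# ≤ fromℕ k
  1≤fromℕ 1≤k = ≤-cong (solve 0 (𝟙 :+ 𝟘 := 𝟙) refl) refl (fromℕ-mono 1≤k)

  fromℕ-pred : ∀ {k} → 1 ≤ℕ k → fromℕ k -ᶠ 1# ≡ fromℕ (ℕ.pred k)
  fromℕ-pred {suc k} _ = solve 1 (λ x → (𝟙 :+ x) :- 𝟙 := x) refl (fromℕ k)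

module FinEquality where
  open import Data.Bool using (Bool; true; false)
  open import Data.Fin using (_≟_)
  open import Relation.Binary.PropositionalEquality using (refl)
  open import Relation.Nullary using (yes; no; does)
  open import Data.Empty using (⊥-elim)

  _==_ : ∀ {m} → Fin m → Fin m → Bool
  x == y = does (x ≟ y)

  ==-refl : ∀ {m} (x : Fin m) → (x == x) ≡ true
  ==-refl x with x ≟ x
  ... | yes _ = refl
  ... | no x≢x = ⊥-elim (x≢x refl)

  ==-≢ : ∀ {m} {x y : Fin m} → x ≢ y → (x == y) ≡ false
  ==-≢ {x = x} {y} x≢y with x ≟ y
  ... | yes x≡y = ⊥-elim (x≢y x≡y)
  ... | no _ = refl

  ==-injective : ∀ {m n} (e : Fin m → Fin n) → Injective _≡_ _≡_ e → ∀ x y → (e x == e y) ≡ (x == y)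
  ==-injective e e-inj x y with x ≟ y
  ... | yes refl = ==-refl (e x)
  ... | no x≢y = ==-≢ (λ ex≡ey → x≢y (e-inj ex≡ey))

module Counting where
  open import Data.Bool using (Bool; true; false; _∧_; _∨_; not; if_then_else_)
  open import Data.Nat using (zero; suc; _+_; z≤n; s≤s)
  import Data.Nat.Properties as ℕ
  open import Relation.Binary.PropositionalEquality using (refl; cong; trans; sym)

  count : ∀ m → (Fin m → Bool) → ℕ
  count zero b = 0
  count (suc m) b = (if b Fin.zero then 1 else 0) + count m (λ i → b (Fin.suc i))

  count≤ : ∀ m b → count m b ≤ℕ m
  count≤ zero b = z≤n
  count≤ (suc m) b with b Fin.zero
  ... | true = s≤s (count≤ m _)
  ... | false = ℕ.m≤n⇒m≤1+n (count≤ m _)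

  count-∨ : ∀ m (a b : Fin m → Bool) → count m (λ i → a i ∨ b i) ≡ count m b + count m (λ i → a i ∧ not (b i))
  count-∨ zero a b = refl
  count-∨ (suc m) a b with a Fin.zero | b Fin.zero | count-∨ m (λ i → a (Fin.suc i)) (λ i → b (Fin.suc i))
  ... | true  | true  | ih = cong suc ih
  ... | false | true  | ih = cong suc ih
  ... | true  | false | ih = trans (cong suc ih) (sym (ℕ.+-suc _ _))
  ... | false | false | ih = ih

module FiniteSums (𝔽 : OrderedField) where
  open OrderedField 𝔽
  open OrderedFieldFacts 𝔽
  open FinEquality
  open Counting
  open import Data.Bool using (Bool; true; false; _∧_; _∨_; not)
  open import Data.Fin using (_≟_)
  open import Data.Fin.Properties using (suc-injective; any?)
  open import Data.Nat using (zero; suc)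
  open import Data.Product using (∃)
  open import Data.Empty using (⊥-elim)
  open import Relation.Nullary using (Dec; yes; no)
  open import Relation.Binary.PropositionalEquality using (refl; sym; trans; cong; cong₂; module ≡-Reasoning)
  open ≡-Reasoning

  sumFin-cong : ∀ m {g h : Fin m → Carrier} → (∀ i → g i ≡ h i) → sumFin m g ≡ sumFin m h
  sumFin-cong zero g≡h = refl
  sumFin-cong (suc m) g≡h = cong₂ _+_ (g≡h Fin.zero) (sumFin-cong m (λ i → g≡h (Fin.suc i)))

  sumFin-+ : ∀ m (g h : Fin m → Carrier) → sumFin m (λ i → g i + h i) ≡ sumFin m g + sumFin m h
  sumFin-+ zero g h = solve 0 (𝟘 := 𝟘 :+ 𝟘) refl
  sumFin-+ (suc m) g h = trans (cong (g Fin.zero + h Fin.zero +_) (sumFin-+ m _ _))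
    (solve 4 (λ a b c d → (a :+ b) :+ (c :+ d) := (a :+ c) :+ (b :+ d)) refl _ _ _ _)

  sumFin-*ʳ : ∀ m (g : Fin m → Carrier) c → sumFin m (λ i → g i * c) ≡ sumFin m g * c
  sumFin-*ʳ zero g c = solve 1 (λ c → 𝟘 := 𝟘 :* c) refl c
  sumFin-*ʳ (suc m) g c = trans (cong (g Fin.zero * c +_) (sumFin-*ʳ m _ c))
    (solve 3 (λ a b c → a :* c :+ b :* c := (a :+ b) :* c) refl _ _ _)

  sumFin-const : ∀ m c → sumFin m (λ _ → c) ≡ fromℕ m * c
  sumFin-const zero c = solve 1 (λ c → 𝟘 := 𝟘 :* c) refl c
  sumFin-const (suc m) c = trans (cong (c +_) (sumFin-const m c))
    (solve 2 (λ a c → c :+ a :* c := (𝟙 :+ a) :* c) refl _ c)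

  sumFin-zero : ∀ m → sumFin m (λ _ → 0#) ≡ 0#
  sumFin-zero m = trans (sumFin-const m 0#) (solve 1 (λ a → a :* 𝟘 := 𝟘) refl _)

  sumFin-mono : ∀ m {g h : Fin m → Carrier} → (∀ i → g i ≤ h i) → sumFin m g ≤ sumFin m h
  sumFin-mono zero g≤h = ≤-refl
  sumFin-mono (suc m) g≤h = +-mono₂-≤ (g≤h Fin.zero) (sumFin-mono m (λ i → g≤h (Fin.suc i)))

  sumFin-indicator : ∀ m (k : Fin m) (g : Fin m → Carrier) → sumFin m (λ i → ifB 𝔽 (k == i) (g i)) ≡ g k
  sumFin-indicator (suc m) Fin.zero g =
    trans (cong (g Fin.zero +_) (sumFin-zero m)) (solve 1 (λ x → x :+ 𝟘 := x) refl _)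
  sumFin-indicator (suc m) (Fin.suc k) g =
    trans (cong (0# +_) (sumFin-indicator m k (λ i → g (Fin.suc i)))) (solve 1 (λ x → 𝟘 :+ x := x) refl _)

  erase : ∀ {m} → (Fin m → Carrier) → Fin m → Fin m → Carrier
  erase h p v = ifB 𝔽 (not (p == v)) (h v)

  sumFin-erase : ∀ m (h : Fin m → Carrier) p → sumFin m h ≡ h p + sumFin m (erase h p)
  sumFin-erase m h p = begin
    sumFin m h                                                        ≡⟨ sumFin-cong m split ⟩
    sumFin m (λ v → ifB 𝔽 (p == v) (h v) + erase h p v)               ≡⟨ sumFin-+ m _ _ ⟩
    sumFin m (λ v → ifB 𝔽 (p == v) (h v)) + sumFin m (erase h p)      ≡⟨ cong (_+ sumFin m (erase h p)) (sumFin-indicator m p h) ⟩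
    h p + sumFin m (erase h p)                                        ∎
    where
    split : ∀ v → h v ≡ ifB 𝔽 (p == v) (h v) + erase h p v
    split v with p == v
    ... | true = solve 1 (λ x → x := x :+ 𝟘) refl _
    ... | false = solve 1 (λ x → x := 𝟘 :+ x) refl _

  sumFin-image : ∀ m n (e : Fin m → Fin n) → Injective _≡_ _≡_ e → (h : Fin n → Carrier) →
    (∀ v → (∀ k → e k ≢ v) → h v ≡ 0#) → sumFin n h ≡ sumFin m (λ k → h (e k))
  sumFin-image zero n e e-inj h off = trans (sumFin-cong n (λ v → off v (λ ()))) (sumFin-zero n)
  sumFin-image (suc m) n e e-inj h off = begin
    sumFin n h                                                   ≡⟨ sumFin-erase n h e₀ ⟩
    h e₀ + sumFin n (erase h e₀)                                 ≡⟨ cong (h e₀ +_) (sumFin-image m n e′ e′-inj _ off′) ⟩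
    h e₀ + sumFin m (λ k → erase h e₀ (e′ k))                    ≡⟨ cong (h e₀ +_) (sumFin-cong m kept) ⟩
    h e₀ + sumFin m (λ k → h (e′ k))                             ∎
    where
    e₀ = e Fin.zero
    e′ : Fin m → Fin n
    e′ k = e (Fin.suc k)
    e′-inj : Injective _≡_ _≡_ e′
    e′-inj eq = suc-injective (e-inj eq)
    kept : ∀ k → erase h e₀ (e′ k) ≡ h (e′ k)
    kept k rewrite ==-injective e e-inj Fin.zero (Fin.suc k) = refl
    off′ : ∀ v → (∀ k → e′ k ≢ v) → erase h e₀ v ≡ 0#
    off′ v v∉e′ with e₀ ≟ v
    ... | yes _ = refl
    ... | no e₀≢v = off v λ { Fin.zero → e₀≢v ; (Fin.suc k) → v∉e′ k }

  sumFin-two-images : ∀ m n (e₁ e₂ : Fin m → Fin n) → Injective _≡_ _≡_ e₁ → Injective _≡_ _≡_ e₂ →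
    (∀ a b → e₁ a ≢ e₂ b) → (h : Fin n → Carrier) →
    (∀ v → (∀ k → e₁ k ≢ v) → (∀ k → e₂ k ≢ v) → h v ≡ 0#) →
    sumFin n h ≡ sumFin m (λ k → h (e₁ k)) + sumFin m (λ k → h (e₂ k))
  sumFin-two-images m n e₁ e₂ e₁-inj e₂-inj disjoint h off = begin
    sumFin n h                                                ≡⟨ sumFin-cong n split ⟩
    sumFin n (λ v → on e₁ v + on e₂ v)                        ≡⟨ sumFin-+ n _ _ ⟩
    sumFin n (on e₁) + sumFin n (on e₂)                       ≡⟨ cong₂ _+_ (sumFin-image m n e₁ e₁-inj _ (on-off e₁))
                                                                           (sumFin-image m n e₂ e₂-inj _ (on-off e₂)) ⟩
    sumFin m (λ k → on e₁ (e₁ k)) + sumFin m (λ k → on e₂ (e₂ k))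
                                                              ≡⟨ cong₂ _+_ (sumFin-cong m (on-image e₁)) (sumFin-cong m (on-image e₂)) ⟩
    sumFin m (λ k → h (e₁ k)) + sumFin m (λ k → h (e₂ k))     ∎
    where
    image? : (e : Fin m → Fin n) (v : Fin n) → Dec (∃ λ k → e k ≡ v)
    image? e v = any? (λ k → e k ≟ v)
    on : (Fin m → Fin n) → Fin n → Carrier
    on e v with image? e v
    ... | yes _ = h v
    ... | no _ = 0#
    on-off : ∀ e v → (∀ k → e k ≢ v) → on e v ≡ 0#
    on-off e v v∉e with image? e v
    ... | yes (k , ek≡v) = ⊥-elim (v∉e k ek≡v)
    ... | no _ = refl
    on-image : ∀ e k → on e (e k) ≡ h (e k)
    on-image e k with image? e (e k)
    ... | yes _ = refl
    ... | no ek∉e = ⊥-elim (ek∉e (k , refl))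
    split : ∀ v → h v ≡ on e₁ v + on e₂ v
    split v with image? e₁ v | image? e₂ v
    ... | yes (a , refl) | yes (b , e₂b≡v) = ⊥-elim (disjoint a b (sym e₂b≡v))
    ... | yes _ | no _ = solve 1 (λ x → x := x :+ 𝟘) refl _
    ... | no _ | yes _ = solve 1 (λ x → x := 𝟘 :+ x) refl _
    ... | no v∉e₁ | no v∉e₂ =
      trans (off v (λ k ek≡v → v∉e₁ (k , ek≡v)) (λ k ek≡v → v∉e₂ (k , ek≡v))) (solve 0 (𝟘 := 𝟘 :+ 𝟘) refl)

  select : ∀ m → (Fin m → Bool) → (Fin m → Carrier) → Carrier
  select m b w = sumFin m (λ i → ifB 𝔽 (b i) (w i))

  select-count : ∀ m b → select m b (λ _ → 1#) ≡ fromℕ (count m b)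
  select-count zero b = refl
  select-count (suc m) b with b Fin.zero
  ... | true = cong (1# +_) (select-count m _)
  ... | false = trans (cong (0# +_) (select-count m _)) (solve 1 (λ x → 𝟘 :+ x := x) refl _)

  select-split : ∀ m (b b₁ b₂ : Fin m → Bool) w →
    (∀ i → ifB 𝔽 (b i) (w i) ≡ ifB 𝔽 (b₁ i) (w i) + ifB 𝔽 (b₂ i) (w i)) →
    select m b w ≡ select m b₁ w + select m b₂ w
  select-split m b b₁ b₂ w pointwise = trans (sumFin-cong m pointwise) (sumFin-+ m _ _)

  select-∧ : ∀ m (a b : Fin m → Bool) w → select m a w ≡ select m (λ i → a i ∧ b i) w + select m (λ i → a i ∧ not (b i)) w
  select-∧ m a b w = select-split m a _ _ w pointwise
    where
    pointwise : ∀ i → ifB 𝔽 (a i) (w i) ≡ ifB 𝔽 (a i ∧ b i) (w i) + ifB 𝔽 (a i ∧ not (b i)) (w i)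
    pointwise i with a i | b i
    ... | true  | true  = solve 1 (λ x → x := x :+ 𝟘) refl _
    ... | true  | false = solve 1 (λ x → x := 𝟘 :+ x) refl _
    ... | false | _     = solve 0 (𝟘 := 𝟘 :+ 𝟘) refl

  select-∨ : ∀ m (a b : Fin m → Bool) w → select m (λ i → a i ∨ b i) w ≡ select m b w + select m (λ i → a i ∧ not (b i)) w
  select-∨ m a b w = select-split m _ _ _ w pointwise
    where
    pointwise : ∀ i → ifB 𝔽 (a i ∨ b i) (w i) ≡ ifB 𝔽 (b i) (w i) + ifB 𝔽 (a i ∧ not (b i)) (w i)
    pointwise i with a i | b i
    ... | true  | true  = solve 1 (λ x → x := x :+ 𝟘) refl _
    ... | false | true  = solve 1 (λ x → x := x :+ 𝟘) refl _
    ... | true  | false = solve 1 (λ x → x := 𝟘 :+ x) refl _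
    ... | false | false = solve 0 (𝟘 := 𝟘 :+ 𝟘) refl

  select-mono : ∀ m (b b′ : Fin m → Bool) w → (∀ i → NonNeg (w i)) → (∀ i → b i ≡ true → b′ i ≡ true) →
    select m b w ≤ select m b′ w
  select-mono m b b′ w w≥0 b⊆b′ = sumFin-mono m pointwise
    where
    pointwise : ∀ i → ifB 𝔽 (b i) (w i) ≤ ifB 𝔽 (b′ i) (w i)
    pointwise i with b i | b′ i | b⊆b′ i
    ... | true  | true  | _ = ≤-refl
    ... | true  | false | b⊆b′ᵢ with () ← b⊆b′ᵢ refl
    ... | false | true  | _ = w≥0 i
    ... | false | false | _ = ≤-refl

  select-nonneg : ∀ m (b : Fin m → Bool) w → (∀ i → NonNeg (w i)) → NonNeg (select m b w)
  select-nonneg m b w w≥0 = ≤-cong (sumFin-zero m) refl (select-mono m (λ _ → false) b w w≥0 (λ _ ()))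

  select-≤-total : ∀ m (b : Fin m → Bool) w → (∀ i → NonNeg (w i)) → select m b w ≤ sumFin m w
  select-≤-total m b w w≥0 = select-mono m b (λ _ → true) w w≥0 (λ _ _ → refl)

  select-all : ∀ m (b : Fin m → Bool) w → (∀ i → b i ≡ true) → select m b w ≡ sumFin m w
  select-all m b w all = sumFin-cong m (λ i → cong (λ z → ifB 𝔽 z (w i)) (all i))

  select-none : ∀ m (b : Fin m → Bool) w → (∀ i → b i ≡ false) → select m b w ≡ 0#
  select-none m b w none = trans (sumFin-cong m (λ i → cong (λ z → ifB 𝔽 z (w i)) (none i))) (sumFin-zero m)

module SubsetLookup where
  open import Data.Bool using (true; false; _∧_; _∨_; not)
  open import Data.Fin.Subset as Subset using (Subset; _∪_; _∩_; _-_; _─_; _∈_; _∉_; ⁅_⁆)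
  open import Data.Vec using (lookup; _∷_)
  open import Data.Vec.Properties using (lookup-zipWith; lookup-replicate; []=⇒lookup; lookup⇒[]=)
  open import Data.Empty using (⊥-elim)
  open import Relation.Binary.PropositionalEquality using (refl; sym; trans; cong)
  open FinEquality

  lookup-∪ : ∀ {n} (A B : Subset n) v → lookup (A ∪ B) v ≡ lookup A v ∨ lookup B v
  lookup-∪ A B v = lookup-zipWith _∨_ v A B

  lookup-∩ : ∀ {n} (A B : Subset n) v → lookup (A ∩ B) v ≡ lookup A v ∧ lookup B v
  lookup-∩ A B v = lookup-zipWith _∧_ v A B

  lookup-⊥ : ∀ {n} v → lookup (Subset.⊥ {n}) v ≡ false
  lookup-⊥ v = lookup-replicate v false

  lookup-⁅⁆ : ∀ {n} (x v : Fin n) → lookup ⁅ x ⁆ v ≡ (x == v)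
  lookup-⁅⁆ Fin.zero Fin.zero = refl
  lookup-⁅⁆ Fin.zero (Fin.suc v) = lookup-⊥ v
  lookup-⁅⁆ (Fin.suc x) Fin.zero = refl
  lookup-⁅⁆ (Fin.suc x) (Fin.suc v) = lookup-⁅⁆ x v

  lookup-─ : ∀ {n} (A B : Subset n) v → lookup (A ─ B) v ≡ lookup A v ∧ not (lookup B v)
  lookup-─ (true  ∷ A) (true  ∷ B) Fin.zero = refl
  lookup-─ (true  ∷ A) (false ∷ B) Fin.zero = refl
  lookup-─ (false ∷ A) (true  ∷ B) Fin.zero = refl
  lookup-─ (false ∷ A) (false ∷ B) Fin.zero = refl
  lookup-─ (_ ∷ A) (_ ∷ B) (Fin.suc v) = lookup-─ A B v

  lookup-- : ∀ {n} (A : Subset n) x v → lookup (A - x) v ≡ lookup A v ∧ not (x == v)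
  lookup-- A x v = trans (lookup-─ A ⁅ x ⁆ v) (cong (λ z → lookup A v ∧ not z) (lookup-⁅⁆ x v))

  ∉⇒lookup-false : ∀ {n} {x : Fin n} {A} → x ∉ A → lookup A x ≡ false
  ∉⇒lookup-false {x = x} {A} x∉A with lookup A x in eq
  ... | true = ⊥-elim (x∉A (lookup⇒[]= x A eq))
  ... | false = refl

  lookup-true⇒∈ : ∀ {n} {x : Fin n} {A} → lookup A x ≡ true → x ∈ A
  lookup-true⇒∈ {x = x} {A} eq = lookup⇒[]= x A eq

  lookup-false⇒∉ : ∀ {n} {x : Fin n} {A} → lookup A x ≡ false → x ∉ A
  lookup-false⇒∉ eq x∈A with () ← trans (sym ([]=⇒lookup x∈A)) eq

-- Weight of a subset T ⊆ Fin n seen through a labelling e : Fin m → Fin n: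
-- Σ_{k : e k ∈ T} w k.  Both |Ω ∩ T| and Σ_{j_i ∈ T} ξ_i are of this form.
module SubsetWeights (𝔽 : OrderedField) where
  open OrderedField 𝔽
  open OrderedFieldFacts 𝔽
  open FiniteSums 𝔽
  open FinEquality
  open SubsetLookup
  open import Data.Bool using (Bool; true; false; _∧_; _∨_; not)
  open import Data.Fin using (_≟_)
  open import Data.Fin.Subset using (Subset; _∪_; _∩_; ⁅_⁆)
  open import Data.Vec using (lookup)
  open import Relation.Nullary using (yes; no)
  open import Data.Bool.Properties using (∧-comm)
  open import Relation.Binary.PropositionalEquality using (refl; sym; trans; cong; cong₂)

  weight : ∀ {m n} → (Fin m → Fin n) → (Fin m → Carrier) → Subset n → Carrier
  weight {m} e w T = select m (λ k → lookup T (e k)) w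

  weight-insert : ∀ {m n} (e : Fin m → Fin n) → Injective _≡_ _≡_ e → (w : Fin m → Carrier) (T : Subset n) (k₀ : Fin m) →
    lookup T (e k₀) ≡ false → weight e w (⁅ e k₀ ⁆ ∪ T) ≡ w k₀ + weight e w T
  weight-insert {m} e e-inj w T k₀ e₀∉T =
    trans (sumFin-cong m pointwise) (trans (sumFin-+ m _ _) (cong (_+ weight e w T) (sumFin-indicator m k₀ w)))
    where
    pointwise : ∀ k → ifB 𝔽 (lookup (⁅ e k₀ ⁆ ∪ T) (e k)) (w k) ≡ ifB 𝔽 (k₀ == k) (w k) + ifB 𝔽 (lookup T (e k)) (w k)
    pointwise k rewrite lookup-∪ ⁅ e k₀ ⁆ T (e k) | lookup-⁅⁆ (e k₀) (e k) | ==-injective e e-inj k₀ k with k₀ ≟ k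
    ... | yes refl rewrite e₀∉T = solve 1 (λ x → x := x :+ 𝟘) refl _
    ... | no _ = solve 1 (λ x → x := 𝟘 :+ x) refl _

  weight-insert-unlabelled : ∀ {m n} (e : Fin m → Fin n) (v : Fin n) → (∀ k → e k ≢ v) → (w : Fin m → Carrier) (T : Subset n) →
    weight e w (⁅ v ⁆ ∪ T) ≡ weight e w T
  weight-insert-unlabelled {m} e v v∉e w T = sumFin-cong m pointwise
    where
    pointwise : ∀ k → ifB 𝔽 (lookup (⁅ v ⁆ ∪ T) (e k)) (w k) ≡ ifB 𝔽 (lookup T (e k)) (w k)
    pointwise k rewrite lookup-∪ ⁅ v ⁆ T (e k) | lookup-⁅⁆ v (e k) | ==-≢ (λ v≡ek → v∉e k (sym v≡ek)) = refl

  weight-diff : ∀ {m n} → (Fin m → Fin n) → (Fin m → Carrier) → Subset n → Subset n → Carrier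
  weight-diff {m} e w A B = select m (λ k → lookup A (e k) ∧ not (lookup B (e k))) w

  weight-∪ : ∀ {m n} (e : Fin m → Fin n) w (A B : Subset n) → weight e w (A ∪ B) ≡ weight e w B + weight-diff e w A B
  weight-∪ {m} e w A B = trans (sumFin-cong m (λ k → cong (λ b → ifB 𝔽 b (w k)) (lookup-∪ A B (e k))))
                               (select-∨ m (λ k → lookup A (e k)) (λ k → lookup B (e k)) w)

  record Venn (wA wB w∪ w∩ : Carrier) : Set where
    field
      P Q R : Carrier
      eqA : wA ≡ P + Q
      eqB : wB ≡ P + R
      eq∪ : w∪ ≡ P + R + Q
      eq∩ : w∩ ≡ P
      Q≥0 : NonNeg Q
      R≥0 : NonNeg R

  weight-venn : ∀ {m n} (e : Fin m → Fin n) w → (∀ k → NonNeg (w k)) → ∀ A B →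
    Venn (weight e w A) (weight e w B) (weight e w (A ∪ B)) (weight e w (A ∩ B))
  weight-venn {m} e w w≥0 A B = record
    { P = select m (λ k → a k ∧ b k) w
    ; Q = select m (λ k → a k ∧ not (b k)) w
    ; R = select m (λ k → b k ∧ not (a k)) w
    ; eqA = select-∧ m a b w
    ; eqB = eqB
    ; eq∪ = trans (weight-∪ e w A B) (cong (_+ select m (λ k → a k ∧ not (b k)) w) eqB)
    ; eq∩ = sumFin-cong m (λ k → cong (λ z → ifB 𝔽 z (w k)) (lookup-∩ A B (e k)))
    ; Q≥0 = select-nonneg m _ w w≥0
    ; R≥0 = select-nonneg m _ w w≥0
    }
    where
    a b : Fin m → Bool
    a k = lookup A (e k)
    b k = lookup B (e k)
    eqB : weight e w B ≡ select m (λ k → a k ∧ b k) w + select m (λ k → b k ∧ not (a k)) w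
    eqB = trans (select-∧ m b a w)
      (cong (_+ select m (λ k → b k ∧ not (a k)) w) (sumFin-cong m (λ k → cong (λ z → ifB 𝔽 z (w k)) (∧-comm (b k) (a k)))))

module Analysis (𝔽 : OrderedField) (K n : ℕ) (α γ : OrderedField.Carrier 𝔽) (j ω : Fin K → Fin n) where
  open OrderedField 𝔽
  open OrderedFieldFacts 𝔽
  open FiniteSums 𝔽
  open SubsetWeights 𝔽
  open SubsetLookup
  open FinEquality using (_==_; ==-refl)
  open Counting
  open Construction 𝔽 K n α γ j ω
  open import Data.Bool using (true; false; _∧_; _∨_; not)
  open import Data.Nat as ℕ using (zero; suc)
  import Data.Nat.Properties as ℕ
  open import Data.Fin.Subset as Subset using (Subset; _∪_; _∩_; _-_; ⁅_⁆)
  open import Data.Vec using (lookup; tabulate)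
  open import Data.Vec.Properties using (lookup∘tabulate)
  open import Data.Fin using (_≟_)
  open import Data.Fin.Properties using (any?; toℕ-fromℕ<)
  open import Relation.Nullary using (yes; no; does)
  open import Data.Product using (proj₁; proj₂)
  open import Data.Empty using (⊥-elim)
  open import Relation.Binary.PropositionalEquality using (refl; sym; trans; cong; cong₂; subst; module ≡-Reasoning)
  open ≡-Reasoning

  Kinv : Carrier
  Kinv = Kᶠ ⁻¹

  p q : Carrier
  p = (γ ⁻¹ -ᶠ 1#) / (Kᶠ -ᶠ 1#)
  q = (Kᶠ -ᶠ γ ⁻¹) / (Kᶠ -ᶠ 1#)

  u Δ : Carrier → Carrier
  u x = f x / Kᶠ
  Δ x = f (x + 1#) -ᶠ f x

  discount : Carrier → Carrier
  discount y = 1# -ᶠ α * γ * y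

  F-via : ∀ T {c s} → countΩ T ≡ c → sumξ T ≡ s → F T ≡ u c * discount s + s
  F-via T refl refl = refl

  countℕ : Subset n → ℕ
  countℕ T = count K (λ k → lookup T (ω k))

  countΩ≡ : ∀ T → countΩ T ≡ fromℕ (countℕ T)
  countΩ≡ T = select-count K (λ k → lookup T (ω k))

  countΩ-full : ∀ T → (∀ k → lookup T (ω k) ≡ true) → countΩ T ≡ Kᶠ
  countΩ-full T Ω⊆T = trans (select-all K _ _ Ω⊆T) (trans (sumFin-const K 1#) (solve 1 (λ k → k :* 𝟙 := k) refl Kᶠ))

  data Kind (v : Fin n) : Set where
    in-S  : ∀ k → j k ≡ v → Kind v
    in-Ω  : ∀ k → ω k ≡ v → Kind v
    dummy : (∀ k → j k ≢ v) → (∀ k → ω k ≢ v) → Kind v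

  kind : ∀ v → Kind v
  kind v with any? (λ k → j k ≟ v) | any? (λ k → ω k ≟ v)
  ... | yes (k , jk≡v) | _              = in-S k jk≡v
  ... | no _           | yes (k , ωk≡v) = in-Ω k ωk≡v
  ... | no v∉S         | no v∉Ω         = dummy (λ k jk≡v → v∉S (k , jk≡v)) (λ k ωk≡v → v∉Ω (k , ωk≡v))

  Ωset : Subset n
  Ωset = tabulate (λ v → does (any? (λ k → ω k ≟ v)))

  Ωset-ω : ∀ k → lookup Ωset (ω k) ≡ true
  Ωset-ω k rewrite lookup∘tabulate (λ v → does (any? (λ k → ω k ≟ v))) (ω k) with any? (λ k′ → ω k′ ≟ ω k)
  ... | yes _ = refl
  ... | no ωk∉Ω = ⊥-elim (ωk∉Ω (k , refl))

  module Marginals (j-inj : Injective _≡_ _≡_ j) (ω-inj : Injective _≡_ _≡_ ω) (j≢ω : ∀ a b → j a ≢ ω b) where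

    gain-ω : ∀ T k → lookup T (ω k) ≡ false → ρ₁ 𝔽 F (ω k) T ≡ Δ (countΩ T) * Kinv * discount (sumξ T)
    gain-ω T k ωk∉T = begin
      F (⁅ ω k ⁆ ∪ T) -ᶠ F T
        ≡⟨ cong₂ (λ c s → (u c * discount s + s) -ᶠ F T)
                 (trans (weight-insert ω ω-inj (λ _ → 1#) T k ωk∉T) (solve 1 (λ c → 𝟙 :+ c := c :+ 𝟙) refl c))
                 (weight-insert-unlabelled j (ω k) (λ k′ → j≢ω k′ k) ξ T) ⟩
      (f (c + 1#) * Kinv * discount s + s) -ᶠ (f c * Kinv * discount s + s)
        ≡⟨ solve 5 (λ f₁ f₀ k d s → (f₁ :* k :* d :+ s) :- (f₀ :* k :* d :+ s) := (f₁ :- f₀) :* k :* d)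
                 refl (f (c + 1#)) (f c) Kinv (discount s) s ⟩
      Δ c * Kinv * discount s ∎
      where
      c = countΩ T
      s = sumξ T

    gain-j : ∀ T k → lookup T (j k) ≡ false → ρ₁ 𝔽 F (j k) T ≡ ξ k * discount (u (countΩ T))
    gain-j T k jk∉T = begin
      F (⁅ j k ⁆ ∪ T) -ᶠ F T
        ≡⟨ cong₂ (λ c s → (u c * discount s + s) -ᶠ F T)
                 (weight-insert-unlabelled ω (j k) (λ k′ ωk′≡jk → j≢ω k k′ (sym ωk′≡jk)) (λ _ → 1#) T)
                 (weight-insert j j-inj ξ T k jk∉T) ⟩
      (f c * Kinv * (1# -ᶠ α * γ * (ξ k + s)) + (ξ k + s)) -ᶠ (f c * Kinv * (1# -ᶠ α * γ * s) + s)
        ≡⟨ solve 6 (λ a g x s k f₀ → (f₀ :* k :* (𝟙 :- a :* g :* (x :+ s)) :+ (x :+ s)) :- (f₀ :* k :* (𝟙 :- a :* g :* s) :+ s)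
                                     := x :* (𝟙 :- a :* g :* (f₀ :* k)))
                 refl α γ (ξ k) s Kinv (f c) ⟩
      ξ k * discount (u c) ∎
      where
      c = countΩ T
      s = sumξ T

    gain-dummy : ∀ T v → (∀ k → j k ≢ v) → (∀ k → ω k ≢ v) → ρ₁ 𝔽 F v T ≡ 0#
    gain-dummy T v v∉j v∉ω = begin
      F (⁅ v ⁆ ∪ T) -ᶠ F T
        ≡⟨ cong₂ (λ c s → (u c * discount s + s) -ᶠ F T)
                 (weight-insert-unlabelled ω v v∉ω (λ _ → 1#) T) (weight-insert-unlabelled j v v∉j ξ T) ⟩
      F T -ᶠ F T  ≡⟨ solve 1 (λ x → x :- x := 𝟘) refl (F T) ⟩
      0# ∎

    Ωset-j : ∀ k → lookup Ωset (j k) ≡ false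
    Ωset-j k rewrite lookup∘tabulate (λ v → does (any? (λ k → ω k ≟ v))) (j k) with any? (λ k′ → ω k′ ≟ j k)
    ... | yes (k′ , ωk′≡jk) = ⊥-elim (j≢ω k k′ (sym ωk′≡jk))
    ... | no _ = refl

    singleton-gains : ∀ A B →
      sumFin n (λ v → ifB 𝔽 (lookup A v ∧ not (lookup B v)) (ρ₁ 𝔽 F v B))
        ≡ weight-diff j ξ A B * discount (u (countΩ B)) + weight-diff ω (λ _ → 1#) A B * (Δ (countΩ B) * Kinv * discount (sumξ B))
    singleton-gains A B = begin
      sumFin n h
        ≡⟨ sumFin-two-images K n j ω j-inj ω-inj j≢ω h h-dummy ⟩
      sumFin K (λ k → h (j k)) + sumFin K (λ k → h (ω k))
        ≡⟨ cong₂ _+_ (trans (sumFin-cong K h-j) (sumFin-*ʳ K _ Y)) (trans (sumFin-cong K h-ω) (sumFin-*ʳ K _ Z)) ⟩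
      weight-diff j ξ A B * Y + weight-diff ω (λ _ → 1#) A B * Z ∎
      where
      h : Fin n → Carrier
      h v = ifB 𝔽 (lookup A v ∧ not (lookup B v)) (ρ₁ 𝔽 F v B)
      Y = discount (u (countΩ B))
      Z = Δ (countΩ B) * Kinv * discount (sumξ B)
      h-j : ∀ k → h (j k) ≡ ifB 𝔽 (lookup A (j k) ∧ not (lookup B (j k))) (ξ k) * Y
      h-j k with lookup A (j k) | lookup B (j k) in jk∈?B
      ... | true  | false = gain-j B k jk∈?B
      ... | true  | true  = solve 1 (λ y → 𝟘 := 𝟘 :* y) refl Y
      ... | false | _     = solve 1 (λ y → 𝟘 := 𝟘 :* y) refl Y
      h-ω : ∀ k → h (ω k) ≡ ifB 𝔽 (lookup A (ω k) ∧ not (lookup B (ω k))) 1# * Z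
      h-ω k with lookup A (ω k) | lookup B (ω k) in ωk∈?B
      ... | true  | false = trans (gain-ω B k ωk∈?B) (solve 1 (λ z → z := 𝟙 :* z) refl Z)
      ... | true  | true  = solve 1 (λ z → 𝟘 := 𝟘 :* z) refl Z
      ... | false | _     = solve 1 (λ z → 𝟘 := 𝟘 :* z) refl Z
      h-dummy : ∀ v → (∀ k → j k ≢ v) → (∀ k → ω k ≢ v) → h v ≡ 0#
      h-dummy v v∉j v∉ω with lookup A v ∧ not (lookup B v)
      ... | true = gain-dummy B v v∉j v∉ω
      ... | false = refl

  module Profile (K≥2 : 2 ≤ℕ K) (γ>0 : 0# < γ) (γ≤1 : γ ≤ 1#) where

    -- 1/(K-1), so that p = (1/γ - 1) m and q = (K - 1/γ) m
    m : Carrier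
    m = (Kᶠ -ᶠ 1#) ⁻¹

    1≤K : 1 ≤ℕ K
    1≤K = ℕ.≤-trans (ℕ.n≤1+n 1) K≥2

    K≥1 : 1# ≤ Kᶠ
    K≥1 = 1≤fromℕ 1≤K

    K-1≥1 : 1# ≤ Kᶠ -ᶠ 1#
    K-1≥1 = ≤-cong refl (sym (fromℕ-pred 1≤K)) (1≤fromℕ (ℕ.pred-mono-≤ K≥2))

    Kinv>0 : 0# < Kinv
    Kinv>0 = ⁻¹-positive (≥1⇒positive K≥1)

    m>0 : 0# < m
    m>0 = ⁻¹-positive (≥1⇒positive K-1≥1)

    K·Kinv≡1 : Kᶠ * Kinv ≡ 1#
    K·Kinv≡1 = ⁻¹-inverse Kᶠ (positive⇒≢0 (≥1⇒positive K≥1))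

    γ·γ⁻¹≡1 : γ * γ ⁻¹ ≡ 1#
    γ·γ⁻¹≡1 = ⁻¹-inverse γ (positive⇒≢0 γ>0)

    [K-1]·m≡1 : (Kᶠ -ᶠ 1#) * m ≡ 1#
    [K-1]·m≡1 = ⁻¹-inverse (Kᶠ -ᶠ 1#) (positive⇒≢0 (≥1⇒positive K-1≥1))

    -- γ ≤ 1 gives 1/γ ≥ 1, hence a convex profile
    p≥0 : NonNeg p
    p≥0 = *-nonneg γ⁻¹-1≥0 (proj₁ m>0)
      where
      γ⁻¹-1≥0 : NonNeg (γ ⁻¹ -ᶠ 1#)
      γ⁻¹-1≥0 = nonneg-cancelˡ γ>0 (≤-cong refl
        (trans (cong (_-ᶠ γ) (sym γ·γ⁻¹≡1)) (solve 2 (λ c c′ → c :* c′ :- c := c :* (c′ :- 𝟙)) refl γ (γ ⁻¹)))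
        (≤⇒diff-nonneg γ≤1))

    γ·p : γ * p ≡ (1# -ᶠ γ) * m
    γ·p = begin
      γ * ((γ ⁻¹ -ᶠ 1#) * m)   ≡⟨ solve 3 (λ c c′ m → c :* ((c′ :- 𝟙) :* m) := (c :* c′ :- c) :* m) refl γ (γ ⁻¹) m ⟩
      (γ * γ ⁻¹ -ᶠ γ) * m      ≡⟨ cong (λ w → (w -ᶠ γ) * m) γ·γ⁻¹≡1 ⟩
      (1# -ᶠ γ) * m            ∎

    p+q≡1 : p + q ≡ 1#
    p+q≡1 = trans (solve 3 (λ k c′ m → (c′ :- 𝟙) :* m :+ (k :- c′) :* m := (k :- 𝟙) :* m) refl Kᶠ (γ ⁻¹) m) [K-1]·m≡1

    f-expand : ∀ x → f x ≡ x + p * (x * (x -ᶠ 1#))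
    f-expand x = begin
      p * (x * x) + q * x
        ≡⟨ solve 3 (λ p q x → p :* (x :* x) :+ q :* x := x :+ p :* (x :* (x :- 𝟙)) :+ (p :+ q :- 𝟙) :* x) refl p q x ⟩
      x + p * (x * (x -ᶠ 1#)) + (p + q -ᶠ 1#) * x    ≡⟨ cong (λ w → x + p * (x * (x -ᶠ 1#)) + (w -ᶠ 1#) * x) p+q≡1 ⟩
      x + p * (x * (x -ᶠ 1#)) + (1# -ᶠ 1#) * x       ≡⟨ solve 2 (λ a x → a :+ (𝟙 :- 𝟙) :* x := a) refl _ x ⟩
      x + p * (x * (x -ᶠ 1#))                        ∎

    f-increment : ∀ x d → f (x + d) -ᶠ f x ≡ d * (1# + p * (x + x + d -ᶠ 1#))
    f-increment x d = trans (cong₂ _-ᶠ_ (f-expand (x + d)) (f-expand x))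
      (solve 3 (λ p a b → (a :+ b) :+ p :* ((a :+ b) :* ((a :+ b) :- 𝟙)) :- (a :+ p :* (a :* (a :- 𝟙)))
                          := b :* (𝟙 :+ p :* (a :+ a :+ b :- 𝟙))) refl p x d)

    Δ-expand : ∀ x → Δ x ≡ 1# + p * (x + x)
    Δ-expand x = trans (f-increment x 1#) (solve 2 (λ p x → 𝟙 :* (𝟙 :+ p :* (x :+ x :+ 𝟙 :- 𝟙)) := 𝟙 :+ p :* (x :+ x)) refl p x)

    Δ-nonneg : ∀ {x} → NonNeg x → NonNeg (Δ x)
    Δ-nonneg x≥0 = ≤-cong refl (sym (Δ-expand _)) (nonneg-+ 0≤1 (*-nonneg p≥0 (nonneg-+ x≥0 x≥0)))

    Δ-mono : ∀ {x y} → x ≤ y → Δ x ≤ Δ y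
    Δ-mono {x} {y} x≤y = by-difference _
      (trans (cong₂ _-ᶠ_ (Δ-expand y) (Δ-expand x))
             (solve 3 (λ p x y → (𝟙 :+ p :* (y :+ y)) :- (𝟙 :+ p :* (x :+ x)) := p :* ((y :- x) :+ (y :- x))) refl p x y))
      (*-nonneg p≥0 (nonneg-+ (≤⇒diff-nonneg x≤y) (≤⇒diff-nonneg x≤y)))

    f-mono : ∀ x d → f (fromℕ x) ≤ f (fromℕ x + fromℕ d)
    f-mono x zero = ≤-reflexive (cong f (solve 1 (λ c → c := c :+ 𝟘) refl (fromℕ x)))
    f-mono x (suc d) = by-difference _ (f-increment (fromℕ x) (fromℕ (suc d)))
      (*-nonneg (0≤fromℕ (suc d)) (nonneg-+ 0≤1 (*-nonneg p≥0
        (≤-cong refl (solve 2 (λ a b → a :+ a :+ b := a :+ a :+ (𝟙 :+ b) :- 𝟙) refl (fromℕ x) (fromℕ d))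
                (nonneg-+ (nonneg-+ (0≤fromℕ x) (0≤fromℕ x)) (0≤fromℕ d))))))

    u-mono : ∀ x d → u (fromℕ x) ≤ u (fromℕ x + fromℕ d)
    u-mono x d = *-monoʳ-≤ (proj₁ Kinv>0) (f-mono x d)

    u-0 : u 0# ≡ 0#
    u-0 = solve 3 (λ p q k → (p :* (𝟘 :* 𝟘) :+ q :* 𝟘) :* k := 𝟘) refl p q Kinv

    u-nonneg : ∀ x → NonNeg (u (fromℕ x))
    u-nonneg x = ≤-cong u-0 (cong u (solve 1 (λ c → 𝟘 :+ c := c) refl (fromℕ x))) (u-mono 0 x)

    u-K : u Kᶠ ≡ γ ⁻¹
    u-K = begin
      f Kᶠ * Kinv
        ≡⟨ cong (_* Kinv) (f-expand Kᶠ) ⟩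
      (Kᶠ + p * (Kᶠ * (Kᶠ -ᶠ 1#))) * Kinv
        ≡⟨ solve 4 (λ k c′ m k′ → (k :+ (c′ :- 𝟙) :* m :* (k :* (k :- 𝟙))) :* k′
                                  := c′ :* (k :* k′) :+ (c′ :- 𝟙) :* (k :* k′) :* ((k :- 𝟙) :* m :- 𝟙))
                 refl Kᶠ (γ ⁻¹) m Kinv ⟩
      γ ⁻¹ * (Kᶠ * Kinv) + (γ ⁻¹ -ᶠ 1#) * (Kᶠ * Kinv) * ((Kᶠ -ᶠ 1#) * m -ᶠ 1#)
        ≡⟨ cong₂ (λ a b → γ ⁻¹ * a + (γ ⁻¹ -ᶠ 1#) * a * (b -ᶠ 1#)) K·Kinv≡1 [K-1]·m≡1 ⟩
      γ ⁻¹ * 1# + (γ ⁻¹ -ᶠ 1#) * 1# * (1# -ᶠ 1#)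
        ≡⟨ solve 1 (λ c′ → c′ :* 𝟙 :+ (c′ :- 𝟙) :* 𝟙 :* (𝟙 :- 𝟙) := c′) refl (γ ⁻¹) ⟩
      γ ⁻¹ ∎

    γu-K : γ * u Kᶠ ≡ 1#
    γu-K = trans (cong (γ *_) u-K) γ·γ⁻¹≡1

    γu≤1 : ∀ {x} → x ≤ℕ K → γ * u (fromℕ x) ≤ 1#
    γu≤1 {x} x≤K = ≤-cong refl γu-K
      (*-monoˡ-≤ (proj₁ γ>0) (≤-cong refl (cong u (sym (fromℕ-split x≤K))) (u-mono x (K ℕ.∸ x))))

    profile-ratio : ∀ x d → x ℕ.+ d ≤ℕ K → γ * (f (fromℕ x + fromℕ d) -ᶠ f (fromℕ x)) ≤ fromℕ d * Δ (fromℕ x)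
    profile-ratio x d x+d≤K = by-difference _ difference
      (*-nonneg (*-nonneg (0≤fromℕ d) (≤⇒diff-nonneg γ≤1))
                (nonneg-+ (*-nonneg p≥0 (nonneg-+ (0≤fromℕ x) (0≤fromℕ x)))
                          (*-nonneg (proj₁ m>0) (≤⇒diff-nonneg (fromℕ-mono (ℕ.m+n≤o⇒n≤o x x+d≤K))))))
      where
      c = fromℕ x
      D = fromℕ d
      difference : D * Δ c -ᶠ γ * (f (c + D) -ᶠ f c) ≡ D * (1# -ᶠ γ) * (p * (c + c) + m * (Kᶠ -ᶠ D))
      difference = begin
        D * Δ c -ᶠ γ * (f (c + D) -ᶠ f c)
          ≡⟨ cong₂ (λ a b → D * a -ᶠ γ * b) (Δ-expand c) (f-increment c D) ⟩
        D * (1# + p * (c + c)) -ᶠ γ * (D * (1# + p * (c + c + D -ᶠ 1#)))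
          ≡⟨ solve 4 (λ D c p g → D :* (𝟙 :+ p :* (c :+ c)) :- g :* (D :* (𝟙 :+ p :* (c :+ c :+ D :- 𝟙)))
                                  := D :* (𝟙 :- g) :* (𝟙 :+ p :* (c :+ c)) :- D :* (g :* p) :* (D :- 𝟙)) refl D c p γ ⟩
        D * (1# -ᶠ γ) * (1# + p * (c + c)) -ᶠ D * (γ * p) * (D -ᶠ 1#)
          ≡⟨ cong (λ w → D * (1# -ᶠ γ) * (1# + p * (c + c)) -ᶠ D * w * (D -ᶠ 1#)) γ·p ⟩
        D * (1# -ᶠ γ) * (1# + p * (c + c)) -ᶠ D * ((1# -ᶠ γ) * m) * (D -ᶠ 1#)
          ≡⟨ solve 6 (λ D c p g m k → D :* (𝟙 :- g) :* (𝟙 :+ p :* (c :+ c)) :- D :* ((𝟙 :- g) :* m) :* (D :- 𝟙)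
                                      := D :* (𝟙 :- g) :* (p :* (c :+ c) :+ m :* (k :- D)) :+ D :* (𝟙 :- g) :* (𝟙 :- (k :- 𝟙) :* m))
                   refl D c p γ m Kᶠ ⟩
        D * (1# -ᶠ γ) * (p * (c + c) + m * (Kᶠ -ᶠ D)) + D * (1# -ᶠ γ) * (1# -ᶠ (Kᶠ -ᶠ 1#) * m)
          ≡⟨ cong (λ w → D * (1# -ᶠ γ) * (p * (c + c) + m * (Kᶠ -ᶠ D)) + D * (1# -ᶠ γ) * (1# -ᶠ w)) [K-1]·m≡1 ⟩
        D * (1# -ᶠ γ) * (p * (c + c) + m * (Kᶠ -ᶠ D)) + D * (1# -ᶠ γ) * (1# -ᶠ 1#)
          ≡⟨ solve 2 (λ a b → a :+ b :* (𝟙 :- 𝟙) := a) refl _ _ ⟩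
        D * (1# -ᶠ γ) * (p * (c + c) + m * (Kᶠ -ᶠ D)) ∎

  module Weights (K≥2 : 2 ≤ℕ K) (γ>0 : 0# < γ) (γ≤1 : γ ≤ 1#) (α≥0 : 0# ≤ α) (α≤1 : α ≤ 1#) where
    open Profile K≥2 γ>0 γ≤1

    r : Carrier
    r = (Kᶠ -ᶠ γ * α) / Kᶠ

    γα≤1 : γ * α ≤ 1#
    γα≤1 = ≤-trans (*-monoˡ-≤ (proj₁ γ>0) α≤1) (≤-cong (solve 1 (λ c → c := c :* 𝟙) refl γ) refl γ≤1)

    r-nonneg : NonNeg r
    r-nonneg = *-nonneg (≤⇒diff-nonneg (≤-trans γα≤1 K≥1)) (proj₁ Kinv>0)

    r≤1 : r ≤ 1#
    r≤1 = by-difference _ difference (*-nonneg (*-nonneg (proj₁ γ>0) α≥0) (proj₁ Kinv>0))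
      where
      difference : 1# -ᶠ r ≡ γ * α * Kinv
      difference = begin
        1# -ᶠ (Kᶠ -ᶠ γ * α) * Kinv
          ≡⟨ solve 4 (λ k c a k′ → 𝟙 :- (k :- c :* a) :* k′ := c :* a :* k′ :+ (𝟙 :- k :* k′)) refl Kᶠ γ α Kinv ⟩
        γ * α * Kinv + (1# -ᶠ Kᶠ * Kinv) ≡⟨ cong (λ w → γ * α * Kinv + (1# -ᶠ w)) K·Kinv≡1 ⟩
        γ * α * Kinv + (1# -ᶠ 1#)       ≡⟨ solve 1 (λ a → a :+ (𝟙 :- 𝟙) := a) refl _ ⟩
        γ * α * Kinv                    ∎

    r^-bounds : ∀ t → NonNeg (r ^ t) × (r ^ t ≤ 1#)
    r^-bounds zero = 0≤1 , ≤-refl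
    r^-bounds (suc t) = *-nonneg r-nonneg (proj₁ (r^-bounds t))
                      , ≤-trans (*-monoˡ-≤ r-nonneg (proj₂ (r^-bounds t))) (≤-cong (solve 1 (λ x → x := x :* 𝟙) refl r) refl r≤1)

    ξ-nonneg : ∀ i → NonNeg (ξ i)
    ξ-nonneg i = *-nonneg (*-nonneg 0≤1 (proj₁ Kinv>0)) (proj₁ (r^-bounds (Fin.toℕ i)))

    ξ≤Kinv : ∀ i → ξ i ≤ Kinv
    ξ≤Kinv i = ≤-trans (*-monoˡ-≤ (*-nonneg 0≤1 (proj₁ Kinv>0)) (proj₂ (r^-bounds (Fin.toℕ i))))
                       (≤-reflexive (solve 1 (λ x → (𝟙 :* x) :* 𝟙 := x) refl Kinv))

    ξ-first : (i : Fin K) → Fin.toℕ i ≡ 0 → ξ i ≡ Kinv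
    ξ-first i i≡0 = trans (cong (λ t → (1# * Kinv) * (r ^ t)) i≡0) (solve 1 (λ x → (𝟙 :* x) :* 𝟙 := x) refl Kinv)

    sumξ-nonneg : ∀ T → NonNeg (sumξ T)
    sumξ-nonneg T = select-nonneg K _ ξ ξ-nonneg

    sumξ≤1 : ∀ T → sumξ T ≤ 1#
    sumξ≤1 T = ≤-trans (select-≤-total K _ ξ ξ-nonneg)
                       (≤-trans (sumFin-mono K ξ≤Kinv) (≤-reflexive (trans (sumFin-const K Kinv) K·Kinv≡1)))

    γ·≤1 : ∀ {s} → s ≤ 1# → γ * s ≤ 1#
    γ·≤1 {s} s≤1 = ≤-trans (*-monoˡ-≤ (proj₁ γ>0) s≤1) (≤-cong (solve 1 (λ c → c := c :* 𝟙) refl γ) refl γ≤1)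

    discount-nonneg : ∀ {y} → γ * y ≤ 1# → NonNeg (discount y)
    discount-nonneg {y} γy≤1 =
      ≤-cong refl (solve 3 (λ a c y → (𝟙 :- a) :+ a :* (𝟙 :- c :* y) := 𝟙 :- a :* c :* y) refl α γ y)
             (nonneg-+ (≤⇒diff-nonneg α≤1) (*-nonneg α≥0 (≤⇒diff-nonneg γy≤1)))

    discount-curvature : ∀ {y y′} → NonNeg y → γ * y′ ≤ 1# → (1# -ᶠ α) * discount y ≤ discount y′
    discount-curvature {y} {y′} y≥0 γy′≤1 = by-difference _
      (solve 4 (λ a c y y′ → (𝟙 :- a :* c :* y′) :- (𝟙 :- a) :* (𝟙 :- a :* c :* y) := a :* (𝟙 :- c :* y′) :+ (𝟙 :- a) :* (a :* c :* y))
             refl α γ y y′)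
      (nonneg-+ (*-nonneg α≥0 (≤⇒diff-nonneg γy′≤1)) (*-nonneg (≤⇒diff-nonneg α≤1) (*-nonneg (*-nonneg α≥0 (proj₁ γ>0)) y≥0)))

  module Properties (K≥2 : 2 ≤ℕ K) (α≥0 : 0# ≤ α) (α≤1 : α ≤ 1#) (γ>0 : 0# < γ) (γ≤1 : γ ≤ 1#)
                    (j-inj : Injective _≡_ _≡_ j) (ω-inj : Injective _≡_ _≡_ ω) (j≢ω : ∀ a b → j a ≢ ω b) where
    open Marginals j-inj ω-inj j≢ω
    open Profile K≥2 γ>0 γ≤1
    open Weights K≥2 γ>0 γ≤1 α≥0 α≤1

    module VennOf (A B : Subset n) where
      module Ω = Venn (weight-venn ω (λ _ → 1#) (λ _ → 0≤1) A B)
      module S = Venn (weight-venn j ξ ξ-nonneg A B)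

    -- (a) without curvature, F = f(|Ω ∩ T|)/K + Σξ with f convex: supermodular
    supermodular : α ≡ 0# → Supermodular 𝔽 F
    supermodular α≡0 A B =
      by-difference _ difference (*-nonneg (*-nonneg (*-nonneg p≥0 (nonneg-+ Ω.Q≥0 Ω.Q≥0)) Ω.R≥0) (proj₁ Kinv>0))
      where
      open VennOf A B
      F-at : ∀ T {c s} → countΩ T ≡ c → sumξ T ≡ s → F T ≡ (c + p * (c * (c -ᶠ 1#))) * Kinv + s
      F-at T {c} {s} refl refl = begin
        f c * Kinv * (1# -ᶠ α * γ * s) + s    ≡⟨ cong₂ (λ a fc → fc * Kinv * (1# -ᶠ a * γ * s) + s) α≡0 (f-expand c) ⟩
        (c + p * (c * (c -ᶠ 1#))) * Kinv * (1# -ᶠ 0# * γ * s) + s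
          ≡⟨ solve 4 (λ fc k g s → fc :* k :* (𝟙 :- 𝟘 :* g :* s) :+ s := fc :* k :+ s) refl _ Kinv γ s ⟩
        (c + p * (c * (c -ᶠ 1#))) * Kinv + s  ∎
      difference : (F (A ∪ B) + F (A ∩ B)) -ᶠ (F A + F B) ≡ p * (Ω.Q + Ω.Q) * Ω.R * Kinv
      difference = begin
        (F (A ∪ B) + F (A ∩ B)) -ᶠ (F A + F B)
          ≡⟨ cong₂ _-ᶠ_ (cong₂ _+_ (F-at (A ∪ B) Ω.eq∪ S.eq∪) (F-at (A ∩ B) Ω.eq∩ S.eq∩))
                        (cong₂ _+_ (F-at A Ω.eqA S.eqA) (F-at B Ω.eqB S.eqB)) ⟩
        _ ≡⟨ solve 8 (λ p k P Q R P′ Q′ R′ →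
               ((((P :+ R :+ Q) :+ p :* ((P :+ R :+ Q) :* ((P :+ R :+ Q) :- 𝟙))) :* k :+ (P′ :+ R′ :+ Q′))
                 :+ ((P :+ p :* (P :* (P :- 𝟙))) :* k :+ P′))
               :- ((((P :+ Q) :+ p :* ((P :+ Q) :* ((P :+ Q) :- 𝟙))) :* k :+ (P′ :+ Q′))
                 :+ (((P :+ R) :+ p :* ((P :+ R) :* ((P :+ R) :- 𝟙))) :* k :+ (P′ :+ R′)))
               := p :* (Q :+ Q) :* R :* k) refl p Kinv Ω.P Ω.Q Ω.R S.P S.Q S.R ⟩
        p * (Ω.Q + Ω.Q) * Ω.R * Kinv ∎

    -- (b) for γ = 1 the profile is linear and the discount makes F submodular
    submodular : γ ≡ 1# → Submodular 𝔽 F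
    submodular γ≡1 A B =
      by-difference _ difference (*-nonneg (*-nonneg α≥0 (proj₁ Kinv>0)) (nonneg-+ (*-nonneg Ω.Q≥0 S.R≥0) (*-nonneg Ω.R≥0 S.Q≥0)))
      where
      open VennOf A B
      p≡0 : p ≡ 0#
      p≡0 = begin
        (γ ⁻¹ -ᶠ 1#) * m            ≡⟨ cong (λ g → (g ⁻¹ -ᶠ 1#) * m) γ≡1 ⟩
        (1# ⁻¹ -ᶠ 1#) * m           ≡⟨ cong (λ w → (w -ᶠ 1#) * m) (solve 1 (λ x → x := 𝟙 :* x) refl (1# ⁻¹)) ⟩
        (1# * 1# ⁻¹ -ᶠ 1#) * m      ≡⟨ cong (λ w → (w -ᶠ 1#) * m) (⁻¹-inverse 1# (λ 1≡0 → 0≢1 (sym 1≡0))) ⟩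
        (1# -ᶠ 1#) * m              ≡⟨ solve 1 (λ m → (𝟙 :- 𝟙) :* m := 𝟘) refl m ⟩
        0#                          ∎
      F-at : ∀ T {c s} → countΩ T ≡ c → sumξ T ≡ s → F T ≡ c * Kinv * (1# -ᶠ α * 1# * s) + s
      F-at T {c} {s} refl refl = begin
        f c * Kinv * (1# -ᶠ α * γ * s) + s                        ≡⟨ cong₂ (λ fc g → fc * Kinv * (1# -ᶠ α * g * s) + s) (f-expand c) γ≡1 ⟩
        (c + p * (c * (c -ᶠ 1#))) * Kinv * (1# -ᶠ α * 1# * s) + s
          ≡⟨ cong (λ p → (c + p * (c * (c -ᶠ 1#))) * Kinv * (1# -ᶠ α * 1# * s) + s) p≡0 ⟩
        (c + 0# * (c * (c -ᶠ 1#))) * Kinv * (1# -ᶠ α * 1# * s) + s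
          ≡⟨ solve 4 (λ c k a s → (c :+ 𝟘 :* (c :* (c :- 𝟙))) :* k :* (𝟙 :- a :* 𝟙 :* s) :+ s := c :* k :* (𝟙 :- a :* 𝟙 :* s) :+ s)
                   refl c Kinv α s ⟩
        c * Kinv * (1# -ᶠ α * 1# * s) + s                         ∎
      difference : (F A + F B) -ᶠ (F (A ∪ B) + F (A ∩ B)) ≡ α * Kinv * (Ω.Q * S.R + Ω.R * S.Q)
      difference = begin
        (F A + F B) -ᶠ (F (A ∪ B) + F (A ∩ B))
          ≡⟨ cong₂ _-ᶠ_ (cong₂ _+_ (F-at A Ω.eqA S.eqA) (F-at B Ω.eqB S.eqB))
                        (cong₂ _+_ (F-at (A ∪ B) Ω.eq∪ S.eq∪) (F-at (A ∩ B) Ω.eq∩ S.eq∩)) ⟩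
        _ ≡⟨ solve 8 (λ a k P Q R P′ Q′ R′ →
               (((P :+ Q) :* k :* (𝟙 :- a :* 𝟙 :* (P′ :+ Q′)) :+ (P′ :+ Q′))
                 :+ ((P :+ R) :* k :* (𝟙 :- a :* 𝟙 :* (P′ :+ R′)) :+ (P′ :+ R′)))
               :- (((P :+ R :+ Q) :* k :* (𝟙 :- a :* 𝟙 :* (P′ :+ R′ :+ Q′)) :+ (P′ :+ R′ :+ Q′))
                 :+ (P :* k :* (𝟙 :- a :* 𝟙 :* P′) :+ P′))
               := a :* k :* (Q :* R′ :+ R :* Q′)) refl α Kinv Ω.P Ω.Q Ω.R S.P S.Q S.R ⟩
        α * Kinv * (Ω.Q * S.R + Ω.R * S.Q) ∎

    -- The ratio inequality in terms of the data of F: B has count c = x and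
    -- weight s, and A ∖ B adds d elements of Ω and weight E from S.
    gain-ratio : ∀ x d → x ℕ.+ d ≤ℕ K → ∀ {s E} → NonNeg s → NonNeg E → s + E ≤ 1# →
      let c = fromℕ x ; D = fromℕ d in
      γ * ((u (c + D) * discount (s + E) + (s + E)) -ᶠ (u c * discount s + s))
        ≤ E * discount (u c) + D * (Δ c * Kinv * discount s)
    gain-ratio x d x+d≤K {s} {E} s≥0 E≥0 s+E≤1 = by-difference _ difference
      (nonneg-+ (*-nonneg (*-nonneg (≤⇒diff-nonneg (profile-ratio x d x+d≤K)) (proj₁ Kinv>0)) (discount-nonneg (γ·≤1 s≤1)))
                (*-nonneg E≥0 (nonneg-+ (*-nonneg (≤⇒diff-nonneg γ≤1) (discount-nonneg (γu≤1 (ℕ.m+n≤o⇒m≤o x x+d≤K))))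
                                        (*-nonneg (*-nonneg (*-nonneg α≥0 (proj₁ γ>0)) (proj₁ γ>0)) (≤⇒diff-nonneg (u-mono x d))))))
      where
      c = fromℕ x
      D = fromℕ d
      s≤1 : s ≤ 1#
      s≤1 = ≤-trans (≤-cong (solve 1 (λ s → s :+ 𝟘 := s) refl s) refl (+-mono₂-≤ ≤-refl E≥0)) s+E≤1
      -- the gap splits into the profile's own ratio gap and a curvature gap on E
      difference : (E * discount (u c) + D * (Δ c * Kinv * discount s))
                   -ᶠ γ * ((u (c + D) * discount (s + E) + (s + E)) -ᶠ (u c * discount s + s))
                 ≡ (D * Δ c -ᶠ γ * (f (c + D) -ᶠ f c)) * Kinv * discount s
                   + E * ((1# -ᶠ γ) * discount (u c) + α * γ * γ * (u (c + D) -ᶠ u c))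
      difference = solve 9 (λ E a g f₀ f₁ D δ k s →
        (E :* (𝟙 :- a :* g :* (f₀ :* k)) :+ D :* (δ :* k :* (𝟙 :- a :* g :* s)))
          :- g :* ((f₁ :* k :* (𝟙 :- a :* g :* (s :+ E)) :+ (s :+ E)) :- (f₀ :* k :* (𝟙 :- a :* g :* s) :+ s))
        := (D :* δ :- g :* (f₁ :- f₀)) :* k :* (𝟙 :- a :* g :* s)
           :+ E :* ((𝟙 :- g) :* (𝟙 :- a :* g :* (f₀ :* k)) :+ a :* g :* g :* (f₁ :* k :- f₀ :* k)))
        refl E α γ (f c) (f (c + D)) D (Δ c) Kinv s

    ratio-satisfied : SatisfiesRatio 𝔽 F γ
    ratio-satisfied A B = ≤-cong (cong (γ *_) joint-gain) (sym singleton-sum) (gain-ratio x d x+d≤K (sumξ-nonneg B) E≥0 s+E≤1)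
      where
      x = countℕ B
      d = count K (λ k → lookup A (ω k) ∧ not (lookup B (ω k)))
      s = sumξ B
      E = weight-diff j ξ A B
      x+d≤K : x ℕ.+ d ≤ℕ K
      x+d≤K = subst (_≤ℕ K) (count-∨ K _ _) (count≤ K _)
      E≥0 : NonNeg E
      E≥0 = select-nonneg K _ ξ ξ-nonneg
      count-∪ : countΩ (A ∪ B) ≡ fromℕ x + fromℕ d
      count-∪ = trans (weight-∪ ω (λ _ → 1#) A B) (cong₂ _+_ (countΩ≡ B) (select-count K _))
      sumξ-∪ : sumξ (A ∪ B) ≡ s + E
      sumξ-∪ = weight-∪ j ξ A B
      s+E≤1 : s + E ≤ 1#
      s+E≤1 = ≤-cong sumξ-∪ refl (sumξ≤1 (A ∪ B))
      joint-gain : (u (fromℕ x + fromℕ d) * discount (s + E) + (s + E)) -ᶠ (u (fromℕ x) * discount s + s) ≡ ρ 𝔽 F A B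
      joint-gain = begin
        (u (fromℕ x + fromℕ d) * discount (s + E) + (s + E)) -ᶠ (u (fromℕ x) * discount s + s)
          ≡⟨ cong (λ c → (u (fromℕ x + fromℕ d) * discount (s + E) + (s + E)) -ᶠ (u c * discount s + s)) (sym (countΩ≡ B)) ⟩
        (u (fromℕ x + fromℕ d) * discount (s + E) + (s + E)) -ᶠ F B
          ≡⟨ cong₂ (λ c s′ → (u c * discount s′ + s′) -ᶠ F B) (sym count-∪) (sym sumξ-∪) ⟩
        ρ 𝔽 F A B ∎
      singleton-sum : sumFin n (λ v → ifB 𝔽 (lookup A v ∧ not (lookup B v)) (ρ₁ 𝔽 F v B))
                    ≡ E * discount (u (fromℕ x)) + fromℕ d * (Δ (fromℕ x) * Kinv * discount s)
      singleton-sum = trans (singleton-gains A B)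
        (cong₂ (λ c D → E * discount (u c) + D * (Δ c * Kinv * discount s)) (countΩ≡ B) (select-count K _))

    -- (c, second half) no larger ratio is admissible: adding all of Ω to ∅ gains
    -- 1/γ at once, while the single-element gains sum to 1
    ratio-maximal : ∀ γ′ → SatisfiesRatio 𝔽 F γ′ → γ′ ≤ γ
    ratio-maximal γ′ sat = *-cancelˡ-≤ (⁻¹-positive γ>0)
      (≤-cong (solve 2 (λ a b → a :* b := b :* a) refl γ′ (γ ⁻¹)) (solve 2 (λ a b → a :* b := b :* a) refl γ (γ ⁻¹)) bound)
      where
      ∅ = Subset.⊥
      count-∅ : countΩ ∅ ≡ 0#
      count-∅ = select-none K _ _ (λ k → lookup-⊥ (ω k))
      sumξ-∅ : sumξ ∅ ≡ 0#
      sumξ-∅ = select-none K _ _ (λ k → lookup-⊥ (j k))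
      count-Ω : countΩ (Ωset ∪ ∅) ≡ Kᶠ
      count-Ω = countΩ-full (Ωset ∪ ∅) (λ k → trans (lookup-∪ Ωset ∅ (ω k)) (cong₂ _∨_ (Ωset-ω k) (lookup-⊥ (ω k))))
      sumξ-Ω : sumξ (Ωset ∪ ∅) ≡ 0#
      sumξ-Ω = select-none K _ _ (λ k → trans (lookup-∪ Ωset ∅ (j k)) (cong₂ _∨_ (Ωset-j k) (lookup-⊥ (j k))))
      joint-gain : ρ 𝔽 F Ωset ∅ ≡ γ ⁻¹
      joint-gain = begin
        F (Ωset ∪ ∅) -ᶠ F ∅
          ≡⟨ cong₂ _-ᶠ_ (F-via (Ωset ∪ ∅) count-Ω sumξ-Ω) (F-via ∅ count-∅ sumξ-∅) ⟩
        (u Kᶠ * discount 0# + 0#) -ᶠ (u 0# * discount 0# + 0#)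
          ≡⟨ cong₂ (λ a b → (a * discount 0# + 0#) -ᶠ (b * discount 0# + 0#)) u-K u-0 ⟩
        (γ ⁻¹ * discount 0# + 0#) -ᶠ (0# * discount 0# + 0#)
          ≡⟨ solve 3 (λ c′ a g → (c′ :* (𝟙 :- a :* g :* 𝟘) :+ 𝟘) :- (𝟘 :* (𝟙 :- a :* g :* 𝟘) :+ 𝟘) := c′)
                   refl (γ ⁻¹) α γ ⟩
        γ ⁻¹ ∎
      new-S : weight-diff j ξ Ωset ∅ ≡ 0#
      new-S = select-none K _ ξ (λ k → cong (_∧ not (lookup ∅ (j k))) (Ωset-j k))
      new-Ω : weight-diff ω (λ _ → 1#) Ωset ∅ ≡ Kᶠ
      new-Ω = trans (select-all K _ _ (λ k → cong₂ (λ a b → a ∧ not b) (Ωset-ω k) (lookup-⊥ (ω k))))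
                    (trans (sumFin-const K 1#) (solve 1 (λ k → k :* 𝟙 := k) refl Kᶠ))
      singleton-sum : sumFin n (λ v → ifB 𝔽 (lookup Ωset v ∧ not (lookup ∅ v)) (ρ₁ 𝔽 F v ∅)) ≡ 1#
      singleton-sum = begin
        _ ≡⟨ singleton-gains Ωset ∅ ⟩
        weight-diff j ξ Ωset ∅ * discount (u (countΩ ∅)) + weight-diff ω (λ _ → 1#) Ωset ∅ * (Δ (countΩ ∅) * Kinv * discount (sumξ ∅))
          ≡⟨ cong₂ (λ E D → E * discount (u (countΩ ∅)) + D * (Δ (countΩ ∅) * Kinv * discount (sumξ ∅))) new-S new-Ω ⟩
        0# * discount (u (countΩ ∅)) + Kᶠ * (Δ (countΩ ∅) * Kinv * discount (sumξ ∅))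
          ≡⟨ cong₂ (λ c s → 0# * discount (u c) + Kᶠ * (Δ c * Kinv * discount s)) count-∅ sumξ-∅ ⟩
        0# * discount (u 0#) + Kᶠ * (Δ 0# * Kinv * discount 0#)
          ≡⟨ cong (λ δ → 0# * discount (u 0#) + Kᶠ * (δ * Kinv * discount 0#)) (Δ-expand 0#) ⟩
        0# * discount (u 0#) + Kᶠ * ((1# + p * (0# + 0#)) * Kinv * discount 0#)
          ≡⟨ solve 6 (λ x p k k′ a g → 𝟘 :* (𝟙 :- a :* g :* x) :+ k :* ((𝟙 :+ p :* (𝟘 :+ 𝟘)) :* k′ :* (𝟙 :- a :* g :* 𝟘)) := k :* k′)
                   refl (u 0#) p Kᶠ Kinv α γ ⟩
        Kᶠ * Kinv                                              ≡⟨ K·Kinv≡1 ⟩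
        1#                                                     ∎
      bound : γ′ * γ ⁻¹ ≤ γ * γ ⁻¹
      bound = ≤-cong (cong (γ′ *_) joint-gain) (trans singleton-sum (sym γ·γ⁻¹≡1)) (sat Ωset ∅)

    -- (d, first half) α is an admissible curvature: enlarging the base from
    -- B ∖ {i} to (B ∖ {i}) ∪ A shrinks each kind of marginal gain by at most 1 - α
    curvature-satisfied : SatisfiesCurvature 𝔽 F α
    curvature-satisfied A B i _ i∉A = compare (kind i)
      where
      T = B - i
      T′ = (B - i) ∪ A
      i∉T : lookup T i ≡ false
      i∉T rewrite lookup-- B i i | ==-refl i with lookup B i
      ... | true = refl
      ... | false = refl
      i∉T′ : lookup T′ i ≡ false
      i∉T′ rewrite lookup-∪ T A i | i∉T | ∉⇒lookup-false i∉A = refl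
      T⊆T′ : ∀ v → lookup T v ≡ true → lookup T′ v ≡ true
      T⊆T′ v v∈T rewrite lookup-∪ T A v | v∈T = refl
      count-mono : countΩ T ≤ countΩ T′
      count-mono = select-mono K _ _ (λ _ → 1#) (λ _ → 0≤1) (λ k → T⊆T′ (ω k))
      γu≤1-T′ : γ * u (countΩ T′) ≤ 1#
      γu≤1-T′ = ≤-cong (cong (λ c → γ * u c) (sym (countΩ≡ T′))) refl (γu≤1 (count≤ K _))
      u-nonneg-T : NonNeg (u (countΩ T))
      u-nonneg-T = ≤-cong refl (cong u (sym (countΩ≡ T))) (u-nonneg (countℕ T))
      compare : Kind i → (1# -ᶠ α) * ρ₁ 𝔽 F i T ≤ ρ₁ 𝔽 F i T′
      compare (in-S k refl) =
        ≤-cong (trans (solve 3 (λ a x y → x :* ((𝟙 :- a) :* y) := (𝟙 :- a) :* (x :* y)) refl α (ξ k) _)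
                      (cong ((1# -ᶠ α) *_) (sym (gain-j T k i∉T))))
               (sym (gain-j T′ k i∉T′))
               (*-monoˡ-≤ (ξ-nonneg k) (discount-curvature u-nonneg-T γu≤1-T′))
      compare (in-Ω k refl) =
        ≤-cong (trans (solve 4 (λ a δ k′ y → δ :* k′ :* ((𝟙 :- a) :* y) := (𝟙 :- a) :* (δ :* k′ :* y)) refl α (Δ (countΩ T)) Kinv _)
                      (cong ((1# -ᶠ α) *_) (sym (gain-ω T k i∉T))))
               (sym (gain-ω T′ k i∉T′))
               (≤-trans (*-monoˡ-≤ (*-nonneg (Δ-nonneg (select-nonneg K _ _ (λ _ → 0≤1))) (proj₁ Kinv>0))
                                   (discount-curvature (sumξ-nonneg T) (γ·≤1 (sumξ≤1 T′))))
                        (*-monoʳ-≤ (discount-nonneg (γ·≤1 (sumξ≤1 T′))) (*-monoʳ-≤ (proj₁ Kinv>0) (Δ-mono count-mono))))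
      compare (dummy i∉S i∉Ω) =
        ≤-cong (trans (solve 1 (λ a → 𝟘 := (𝟙 :- a) :* 𝟘) refl α) (cong ((1# -ᶠ α) *_) (sym (gain-dummy T i i∉S i∉Ω))))
               (sym (gain-dummy T′ i i∉S i∉Ω))
               ≤-refl

    -- (d, second half) no smaller curvature is admissible: the gain of the
    -- first element of S drops from 1/K on ∅ to (1 - α)/K once all of Ω is present
    curvature-minimal : ∀ α′ → SatisfiesCurvature 𝔽 F α′ → α ≤ α′
    curvature-minimal α′ sat = diff-nonneg⇒≤ (≤-cong refl
      (solve 2 (λ a a′ → (𝟙 :- a) :- (𝟙 :- a′) := a′ :- a) refl α α′) (≤⇒diff-nonneg (*-cancelˡ-≤ Kinv>0 bound)))
      where
      k₀ : Fin K
      k₀ = Fin.fromℕ< 1≤K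
      i = j k₀
      B = ⁅ i ⁆
      T = B - i
      T′ = T ∪ Ωset
      T-empty : ∀ v → lookup T v ≡ false
      T-empty v rewrite lookup-- B i v | lookup-⁅⁆ i v with i == v
      ... | true = refl
      ... | false = refl
      ξ-k₀ : ξ k₀ ≡ Kinv
      ξ-k₀ = ξ-first k₀ (toℕ-fromℕ< 1≤K)
      i∉T′ : lookup T′ i ≡ false
      i∉T′ = trans (lookup-∪ T Ωset i) (cong₂ _∨_ (T-empty i) (Ωset-j k₀))
      before : ρ₁ 𝔽 F i T ≡ Kinv * 1#
      before = begin
        ρ₁ 𝔽 F i T                       ≡⟨ gain-j T k₀ (T-empty i) ⟩
        ξ k₀ * discount (u (countΩ T))   ≡⟨ cong₂ (λ x c → x * discount (u c)) ξ-k₀ (select-none K _ _ (λ k → T-empty (ω k))) ⟩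
        Kinv * discount (u 0#)           ≡⟨ cong (λ y → Kinv * discount y) u-0 ⟩
        Kinv * discount 0#               ≡⟨ solve 3 (λ k a g → k :* (𝟙 :- a :* g :* 𝟘) := k :* 𝟙) refl Kinv α γ ⟩
        Kinv * 1#                        ∎
      after : ρ₁ 𝔽 F i T′ ≡ Kinv * (1# -ᶠ α)
      after = begin
        ρ₁ 𝔽 F i T′                      ≡⟨ gain-j T′ k₀ i∉T′ ⟩
        ξ k₀ * discount (u (countΩ T′))  ≡⟨ cong₂ (λ x c → x * discount (u c)) ξ-k₀
                                                  (countΩ-full T′ (λ k → trans (lookup-∪ T Ωset (ω k)) (cong₂ _∨_ (T-empty (ω k)) (Ωset-ω k)))) ⟩
        Kinv * discount (u Kᶠ)           ≡⟨ solve 4 (λ k a g x → k :* (𝟙 :- a :* g :* x) := k :* (𝟙 :- a :* (g :* x))) refl Kinv α γ (u Kᶠ) ⟩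
        Kinv * (1# -ᶠ α * (γ * u Kᶠ))    ≡⟨ cong (λ y → Kinv * (1# -ᶠ α * y)) γu-K ⟩
        Kinv * (1# -ᶠ α * 1#)            ≡⟨ solve 2 (λ k a → k :* (𝟙 :- a :* 𝟙) := k :* (𝟙 :- a)) refl Kinv α ⟩
        Kinv * (1# -ᶠ α)                 ∎
      bound : Kinv * (1# -ᶠ α′) ≤ Kinv * (1# -ᶠ α)
      bound = ≤-cong (trans (cong ((1# -ᶠ α′) *_) before) (solve 2 (λ a k → (𝟙 :- a) :* (k :* 𝟙) := k :* (𝟙 :- a)) refl α′ Kinv)) after
        (sat Ωset B i (lookup-true⇒∈ (trans (lookup-⁅⁆ i i) (==-refl i))) (lookup-false⇒∉ (Ωset-j k₀)))

lemma4 : (𝔽 : OrderedField) → let open OrderedField 𝔽 in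
    (K n : ℕ) (α γ : Carrier) (j ω : Fin K → Fin n) →
    2 ≤ℕ K →
    0# ≤ α → α ≤ 1# →
    0# < γ → γ ≤ 1# →
    Injective _≡_ _≡_ j → Injective _≡_ _≡_ ω → (∀ a b → j a ≢ ω b) →
    let open Construction 𝔽 K n α γ j ω in
    (α ≡ 0# → Supermodular 𝔽 F)
    × (γ ≡ 1# → Submodular 𝔽 F)
    × IsSubmodularityRatio 𝔽 F γ
    × IsCurvature 𝔽 F α
lemma4 𝔽 K n α γ j ω K≥2 α≥0 α≤1 γ>0 γ≤1 j-inj ω-inj j≢ω =
  supermodular , submodular , (ratio-satisfied , ratio-maximal) , (curvature-satisfied , curvature-minimal)
  where open Analysis.Properties 𝔽 K n α γ j ω K≥2 α≥0 α≤1 γ>0 γ≤1 j-inj ω-inj j≢ω
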